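{- Let $M$ be a matroid of rank $r\geq 2$, and let $f$ and $g$ be distinct elements of $M$ such that $f$ is freer than $g$ in $M$. Let $k$ be an integer with $1\leq k\leq r-1$. Then $W_k(f;M)=W_k(g;M)$ if and only if $f$ and $g$ are clones in the matroid obtained from $\tau^{r-k-1}(M)$ by deleting every element of $E(M)-\{f,g\}$ that is parallel to $g$ in $\tau^{r-k-1}(M)$.
   Context: For distinct elements $f,g$ of a matroid $M$, $f$ is freer than $g$ if $g$ is contained in the closure of every circuit of $M$ that contains $f$. $W_k(e;M)$ is the number of rank-$k$ flats of $M$ containing $e$. The truncation $\tau(M)$ is obtained from $M$ by taking the free extension of $M$ by a new element $e$ and then contracting $e$; when $r(M)>0$, the independent sets of $\tau(M)$ are exactly the independent sets of $M$ with at most $r(M)-1$ elements. The $i$-th truncation is defined by $\tau^0(M)=M$ and $\tau^i(M)=\tau(\tau^{i-1}(M))$. Elements $x,y$ of a matroid are clones if the bijection of the ground set that interchanges $x$ and $y$ and fixes every other element is an automorphism. -}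

module Defs where

open import Data.Nat using (ℕ; zero; suc; _<_; _≤_; _∸_; _⊔_; _≡ᵇ_; _<ᵇ_)
open import Data.Bool using (Bool; true; false; T; _∧_; _∨_; not; if_then_else_)
open import Data.Fin using (Fin; _≟_)
open import Data.Fin.Subset
  using (Subset; _∈_; _∉_; _⊆_; ∣_∣; ⁅_⁆; _∪_; _∩_; _─_; _-_)
  renaming (⊥ to ∅)
open import Data.Fin.Subset.Properties using (_∈?_; _⊆?_)
open import Data.Vec using (Vec; []; _∷_; tabulate; lookup)
import Data.Vec.Properties as VecP
import Data.Bool.Properties as BoolP
open import Data.List using (List; []; _∷_; _++_; map; foldr; filterᵇ; length; allFin)
open import Data.Product using (Σ; ∃; _×_; _,_)
open import Relation.Binary.PropositionalEquality using (_≡_)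
open import Relation.Nullary using (¬_)
open import Relation.Nullary.Decidable using (⌊_⌋)

-- Finite matroids on a ground set E ⊆ Fin n, given by a (Boolean)
-- independence oracle.  Independent sets are subsets of E.

record MatroidData (n : ℕ) : Set where
  constructor mkM
  field
    E   : Subset n
    Ind : Subset n → Bool

open MatroidData public

record IsMatroid {n : ℕ} (M : MatroidData n) : Set where
  field
    ind⊆E   : ∀ X → T (Ind M X) → X ⊆ E M
    ind-∅   : T (Ind M ∅)
    ind-sub : ∀ X Y → X ⊆ Y → T (Ind M Y) → T (Ind M X)
    ind-aug : ∀ X Y → T (Ind M X) → T (Ind M Y) → ∣ X ∣ < ∣ Y ∣ →
              ∃ λ y → y ∈ Y × y ∉ X × T (Ind M (⁅ y ⁆ ∪ X))

_∈ᵇ_ : ∀ {n} → Fin n → Subset n → Bool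
x ∈ᵇ X = ⌊ x ∈? X ⌋

_⊆ᵇ_ : ∀ {n} → Subset n → Subset n → Bool
X ⊆ᵇ Y = ⌊ X ⊆? Y ⌋

_≡ˢ_ : ∀ {n} → Subset n → Subset n → Bool
X ≡ˢ Y = ⌊ VecP.≡-dec BoolP._≟_ X Y ⌋

allᵇ : ∀ {a} {A : Set a} → (A → Bool) → List A → Bool
allᵇ p = foldr (λ x b → p x ∧ b) true

allSubsets : ∀ n → List (Subset n)
allSubsets zero    = [] ∷ []
allSubsets (suc n) = map (true ∷_) (allSubsets n) ++ map (false ∷_) (allSubsets n)

module _ {n : ℕ} (M : MatroidData n) where

  rank : Subset n → ℕ
  rank X = foldr _⊔_ 0
             (map ∣_∣ (filterᵇ (λ Y → (Y ⊆ᵇ X) ∧ Ind M Y) (allSubsets n)))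

  rk : ℕ
  rk = rank (E M)

  cl : Subset n → Subset n
  cl X = tabulate (λ e → (e ∈ᵇ E M) ∧ (rank (⁅ e ⁆ ∪ X) ≡ᵇ rank X))

  isFlat : Subset n → Bool
  isFlat F = (F ⊆ᵇ E M) ∧ (cl F ≡ˢ F)

  W : ℕ → Fin n → ℕ
  W k e = length (filterᵇ (λ F → isFlat F ∧ (rank F ≡ᵇ k) ∧ (e ∈ᵇ F))
                          (allSubsets n))

  isCircuit : Subset n → Bool
  isCircuit C = (C ⊆ᵇ E M) ∧ not (Ind M C)
                ∧ allᵇ (λ e → not (e ∈ᵇ C) ∨ Ind M (C - e)) (allFin n)

  Freer : Fin n → Fin n → Set
  Freer f g = ∀ C → T (isCircuit C) → f ∈ C → g ∈ cl C

  Parallel : Fin n → Fin n → Set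
  Parallel x y = ¬ (x ≡ y) × T (isCircuit (⁅ x ⁆ ∪ ⁅ y ⁆))

swapElt : ∀ {n} → Fin n → Fin n → Fin n → Fin n
swapElt x y e with e ≟ x
... | Relation.Nullary.yes _ = y
... | Relation.Nullary.no  _ with e ≟ y
...   | Relation.Nullary.yes _ = x
...   | Relation.Nullary.no  _ = e

-- image of X under the transposition (x y); since the transposition
-- is an involution, e is in the image iff (x y) e ∈ X
swapSet : ∀ {n} → Fin n → Fin n → Subset n → Subset n
swapSet x y X = tabulate (λ e → lookup X (swapElt x y e))

Clones : ∀ {n} → MatroidData n → Fin n → Fin n → Set
Clones M x y = x ∈ E M × y ∈ E M ×
               (∀ X → X ⊆ E M → Ind M (swapSet x y X) ≡ Ind M X)

-- τ(M): independent sets of M of size ≤ r(M) - 1 (and τ(M) = M if r(M) = 0,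
-- where the free extension adds a loop)
τ : ∀ {n} → MatroidData n → MatroidData n
τ M = mkM (E M) (λ X → Ind M X ∧ ((∣ X ∣ <ᵇ rk M) ∨ (rk M ≡ᵇ 0)))

τ^ : ∀ {n} → ℕ → MatroidData n → MatroidData n
τ^ zero    M = M
τ^ (suc i) M = τ (τ^ i M)

delete : ∀ {n} → MatroidData n → Subset n → MatroidData n
delete M D = mkM (E M ─ D) (λ X → Ind M X ∧ (X ⊆ᵇ (E M ─ D)))

parallelSet : ∀ {n} → MatroidData n → Fin n → Fin n → Subset n
parallelSet N f g =
  tabulate (λ e → (e ∈ᵇ E N) ∧ not (e ∈ᵇ (⁅ f ⁆ ∪ ⁅ g ⁆))
                  ∧ isCircuit N (⁅ e ⁆ ∪ ⁅ g ⁆))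

{-# OPTIONS --safe #-}
-- Write A (resp. B) for the rank-k flats containing f but not g (resp. g but not f); then
-- W_k(f) = W_k(g) iff |A| = |B|. Since f is freer than g, f ∉ cl(H - f) for H ∈ A, so by the
-- exchange property ψ H = cl((H - f) ∪ {g}) lies in B; when g is not a loop, ψ is onto B
-- (exchange g for f in a basis through g of a flat of B). Hence |A| = |B| iff ψ is injective,
-- or, when g is a loop (so that A is empty), iff B is empty. Both fail exactly when some
-- independent set Y with f ∈ Y, g ∉ Y, |Y| ≤ k + 1, avoiding the elements parallel to g, becomes
-- dependent when f is replaced by g: two flats with one image produce such a Y, and such a Y,
-- extended to an independent Z of size k + 1, yields two flats cl({f} ∪ (Z - f - b)) with one
-- image, for two elements b ≠ g of the circuit through g in (Y - f) ∪ {g}; that circuit has two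
-- such elements because Y avoids the parallel class of g. Finally the independent sets of
-- τ^(r-k-1)(M) are those of M with at most k + 1 elements, and trading g for f never destroys
-- independence, so the absence of such a Y says exactly that f and g are clones once the
-- parallel class of g is deleted.

module Submission where

open import Defs
open import Data.Bool as Bool using (Bool; true; false; T; _∧_; _∨_; not)
open import Data.Bool.Properties using (T?; T-∧; T-≡; ⇔→≡; ∧-comm; ∨-identityʳ)
open import Data.Empty using (⊥; ⊥-elim)
open import Data.Fin using (Fin; zero; suc; _≟_)
open import Data.Fin.Properties using (any?)
open import Data.Fin.Subset
  using (Subset; _∈_; _∉_; _⊆_; ∣_∣; ⁅_⁆; _∪_; _─_; _-_) renaming (⊥ to ∅)
open import Data.Fin.Subset.Properties
open import Data.List using (List; []; _∷_; map; filterᵇ; foldr; length; allFin)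
open import Data.List.Membership.Propositional using () renaming (_∈_ to _∈ˡ_)
open import Data.List.Membership.Propositional.Properties
  using (∈-map⁺; ∈-map⁻; ∈-++⁺ˡ; ∈-++⁺ʳ; ∈-filter⁺; ∈-filter⁻; ∈-allFin; foldr-selective)
open import Data.List.Properties using (length-map; filter-some; filter-none; filter-≐)
open import Data.List.Relation.Unary.All as All using (All; []; _∷_)
open import Data.List.Relation.Unary.AllPairs using ([]; _∷_)
open import Data.List.Relation.Unary.Any as Any using ()
open import Data.List.Relation.Unary.Unique.Propositional using (Unique)
import Data.List.Relation.Unary.Unique.Propositional.Properties as Unique
open import Data.Nat using (ℕ; zero; suc; _+_; _∸_; _≤_; _<_; _⊔_; _≡ᵇ_; _<ᵇ_; z≤n; s≤s; z<s)
import Data.Nat.Properties as ℕ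
open import Data.Product using (∃; _×_; _,_; proj₁; proj₂)
open import Data.Sum using (_⊎_; inj₁; inj₂; [_,_]′)
open import Data.Unit using (tt)
open import Data.Vec using ([]; _∷_; here; there; tabulate; lookup)
import Data.Vec.Properties as Vec
open import Function using (_∘_; id; _∋_)
open import Function.Bundles using (_⇔_; mk⇔; Equivalence)
import Function.Related.Propositional as Related
open import Function.Properties.Equivalence using () renaming (sym to ⇔-sym; trans to ⇔-trans)
open import Relation.Binary.PropositionalEquality
open import Relation.Nullary using (¬_; Dec; yes; no; ¬?; _×-dec_)
open import Relation.Nullary.Decidable using (toWitness; fromWitness; decidable-stable)

open Equivalence using (to; from)

private variable n : ℕ

x∈⁅y⁆∪p⁻ : ∀ {x} y (p : Subset n) → x ∈ ⁅ y ⁆ ∪ p → x ≡ y ⊎ x ∈ p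
x∈⁅y⁆∪p⁻ y p x∈ with x∈p∪q⁻ ⁅ y ⁆ p x∈
... | inj₁ x∈⁅y⁆ = inj₁ (x∈⁅y⁆⇒x≡y y x∈⁅y⁆)
... | inj₂ x∈p   = inj₂ x∈p

y∈⁅y⁆∪p : ∀ y (p : Subset n) → y ∈ ⁅ y ⁆ ∪ p
y∈⁅y⁆∪p y p = x∈p∪q⁺ (inj₁ (x∈⁅x⁆ y))

p⊆⁅y⁆∪p : ∀ y (p : Subset n) → p ⊆ ⁅ y ⁆ ∪ p
p⊆⁅y⁆∪p y p = q⊆p∪q ⁅ y ⁆ p

x∉⁅y⁆∪p : ∀ {x y} {p : Subset n} → x ≢ y → x ∉ p → x ∉ ⁅ y ⁆ ∪ p
x∉⁅y⁆∪p {y = y} {p} x≢y x∉p = [ x≢y , x∉p ]′ ∘ x∈⁅y⁆∪p⁻ y p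

⁅y⁆∪p⊆q : ∀ {y} {p q : Subset n} → y ∈ q → p ⊆ q → ⁅ y ⁆ ∪ p ⊆ q
⁅y⁆∪p⊆q {y = y} {p} y∈q p⊆q x∈ with x∈⁅y⁆∪p⁻ y p x∈
... | inj₁ refl = y∈q
... | inj₂ x∈p  = p⊆q x∈p

⁅y⁆∪-mono : ∀ y {p q : Subset n} → p ⊆ q → ⁅ y ⁆ ∪ p ⊆ ⁅ y ⁆ ∪ q
⁅y⁆∪-mono y {q = q} p⊆q = ⁅y⁆∪p⊆q (y∈⁅y⁆∪p y q) (p⊆⁅y⁆∪p y q ∘ p⊆q)

x≡y⇒x∈⁅y⁆ : ∀ {x y : Fin n} → x ≡ y → x ∈ ⁅ y ⁆
x≡y⇒x∈⁅y⁆ refl = x∈⁅x⁆ _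

⁅x⁆⊆p : ∀ {x} {p : Subset n} → x ∈ p → ⁅ x ⁆ ⊆ p
⁅x⁆⊆p x∈p y∈⁅x⁆ rewrite x∈⁅y⁆⇒x≡y _ y∈⁅x⁆ = x∈p

x∈p─q⇒x∉q : ∀ {x} (p q : Subset n) → x ∈ p ─ q → x ∉ q
x∈p─q⇒x∉q (_ ∷ p) (false ∷ q) here       ()
x∈p─q⇒x∉q (_ ∷ p) (_ ∷ q)     (there x∈) (there x∈q) = x∈p─q⇒x∉q p q x∈ x∈q

x∈p-y⁻ : ∀ {x} (p : Subset n) y → x ∈ p - y → x ∈ p × x ≢ y
x∈p-y⁻ p y x∈ = p─q⊆p p ⁅ y ⁆ x∈ , λ { refl → x∈p─q⇒x∉q p ⁅ y ⁆ x∈ (x∈⁅x⁆ y) }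

p-y⊆p : ∀ (p : Subset n) y → p - y ⊆ p
p-y⊆p p y = p─q⊆p p ⁅ y ⁆

y∉p-y : ∀ (p : Subset n) y → y ∉ p - y
y∉p-y p y y∈ = proj₂ (x∈p-y⁻ p y y∈) refl

-y-mono : ∀ {p q : Subset n} y → p ⊆ q → p - y ⊆ q - y
-y-mono {p = p} y p⊆q x∈ with x∈p-y⁻ p y x∈
... | x∈p , x≢y = x∈p∧x≢y⇒x∈p-y (p⊆q x∈p) x≢y

∣∅∣≤ : ∀ m → ∣ ∅ {n} ∣ ≤ m
∣∅∣≤ {n} m = subst (_≤ m) (sym (∣⊥∣≡0 n)) z≤n

∣⁅x⁆∪p∣ : ∀ x (p : Subset n) → x ∉ p → ∣ ⁅ x ⁆ ∪ p ∣ ≡ suc ∣ p ∣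
∣⁅x⁆∪p∣ zero    (false ∷ p) _   = cong (suc ∘ ∣_∣) (∪-identityˡ p)
∣⁅x⁆∪p∣ zero    (true ∷ p)  x∉p = ⊥-elim (x∉p here)
∣⁅x⁆∪p∣ (suc x) (false ∷ p) x∉p = ∣⁅x⁆∪p∣ x p (x∉p ∘ there)
∣⁅x⁆∪p∣ (suc x) (true ∷ p)  x∉p = cong suc (∣⁅x⁆∪p∣ x p (x∉p ∘ there))

∣⁅x⁆∪p∣≤ : ∀ x (p : Subset n) → ∣ ⁅ x ⁆ ∪ p ∣ ≤ suc ∣ p ∣
∣⁅x⁆∪p∣≤ zero    (b ∷ p)     = s≤s (subst (_≤ ∣ b ∷ p ∣) (sym (cong ∣_∣ (∪-identityˡ p))) (∣p∣≤∣x∷p∣ b p))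
∣⁅x⁆∪p∣≤ (suc x) (false ∷ p) = ∣⁅x⁆∪p∣≤ x p
∣⁅x⁆∪p∣≤ (suc x) (true ∷ p)  = s≤s (∣⁅x⁆∪p∣≤ x p)

∣p-x∣ : ∀ (p : Subset n) x → x ∈ p → suc ∣ p - x ∣ ≡ ∣ p ∣
∣p-x∣ (true ∷ p)  zero    _          = cong (suc ∘ ∣_∣) (p─⊥≡p p)
∣p-x∣ (false ∷ p) (suc x) (there x∈) = ∣p-x∣ p x x∈
∣p-x∣ (true ∷ p)  (suc x) (there x∈) = cong suc (∣p-x∣ p x x∈)

⁅x⁆∪⁅y⁆∪p-comm : ∀ x y (p : Subset n) → ⁅ x ⁆ ∪ (⁅ y ⁆ ∪ p) ≡ ⁅ y ⁆ ∪ (⁅ x ⁆ ∪ p)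
⁅x⁆∪⁅y⁆∪p-comm x y p = ⊆-antisym (swap x y) (swap y x)
  where
  swap : ∀ x y → ⁅ x ⁆ ∪ (⁅ y ⁆ ∪ p) ⊆ ⁅ y ⁆ ∪ (⁅ x ⁆ ∪ p)
  swap x y = ⁅y⁆∪p⊆q (p⊆⁅y⁆∪p y _ (y∈⁅y⁆∪p x p)) (⁅y⁆∪-mono y (p⊆⁅y⁆∪p x p))

⁅x⁆∪[p-x] : ∀ {x} {p : Subset n} → x ∈ p → ⁅ x ⁆ ∪ (p - x) ≡ p
⁅x⁆∪[p-x] {x = x} {p} x∈p = ⊆-antisym (⁅y⁆∪p⊆q x∈p (p-y⊆p p x)) back
  where
  back : p ⊆ ⁅ x ⁆ ∪ (p - x)
  back {y} y∈p with y ≟ x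
  ... | yes refl = y∈⁅y⁆∪p x _
  ... | no y≢x   = p⊆⁅y⁆∪p x _ (x∈p∧x≢y⇒x∈p-y y∈p y≢x)

[⁅x⁆∪p]-x : ∀ {x} {p : Subset n} → x ∉ p → (⁅ x ⁆ ∪ p) - x ≡ p
[⁅x⁆∪p]-x {x = x} {p} x∉p = ⊆-antisym forth back
  where
  forth : (⁅ x ⁆ ∪ p) - x ⊆ p
  forth y∈ with x∈p-y⁻ _ x y∈
  ... | y∈⁅x⁆∪p , y≢x = [ (λ y≡x → ⊥-elim (y≢x y≡x)) , id ]′ (x∈⁅y⁆∪p⁻ x p y∈⁅x⁆∪p)
  back : p ⊆ (⁅ x ⁆ ∪ p) - x
  back y∈p = x∈p∧x≢y⇒x∈p-y (p⊆⁅y⁆∪p x p y∈p) (λ { refl → x∉p y∈p })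

∃-∈-∉ : (p q : Subset n) → ¬ p ⊆ q → ∃ λ x → x ∈ p × x ∉ q
∃-∈-∉ p q p⊈q with any? (λ x → x ∈? p ×-dec ¬? (x ∈? q))
... | yes witness = witness
... | no none = ⊥-elim (p⊈q λ {x} x∈p → decidable-stable (x ∈? q) (λ x∉q → none (x , x∈p , x∉q)))

∈ᵇ⇔ : ∀ {x} {X : Subset n} → T (x ∈ᵇ X) ⇔ x ∈ X
∈ᵇ⇔ = mk⇔ toWitness fromWitness

⊆ᵇ⁻ : ∀ {X Y : Subset n} → T (X ⊆ᵇ Y) → X ⊆ Y
⊆ᵇ⁻ {X = X} {Y} = toWitness {a? = X ⊆? Y}

⊆ᵇ⁺ : ∀ {X Y : Subset n} → X ⊆ Y → T (X ⊆ᵇ Y)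
⊆ᵇ⁺ {X = X} {Y} = fromWitness {a? = X ⊆? Y}

≡ˢ⇔ : ∀ {X Y : Subset n} → T (X ≡ˢ Y) ⇔ X ≡ Y
≡ˢ⇔ = mk⇔ toWitness fromWitness

T-not⇔ : ∀ {b} → T (not b) ⇔ (¬ T b)
T-not⇔ {false} = mk⇔ (λ _ ()) (λ _ → tt)
T-not⇔ {true}  = mk⇔ (λ ()) (λ ¬tt → ¬tt tt)

T-implies⇔ : ∀ {a b} → T (not a ∨ b) ⇔ (T a → T b)
T-implies⇔ {false} = mk⇔ (λ _ ()) (λ _ → tt)
T-implies⇔ {true}  = mk⇔ (λ b _ → b) (λ a⇒b → a⇒b tt)

T-allᵇ⇔ : ∀ {A : Set} {p : A → Bool} {xs} → T (allᵇ p xs) ⇔ All (T ∘ p) xs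
T-allᵇ⇔ {xs = []}     = mk⇔ (λ _ → []) (λ _ → tt)
T-allᵇ⇔ {xs = x ∷ xs} = mk⇔
  (λ t → let px , pxs = to T-∧ t in px ∷ to T-allᵇ⇔ pxs)
  (λ { (px ∷ pxs) → from T-∧ (px , from T-allᵇ⇔ pxs) })

T-injective : ∀ {a b} → T a ⇔ T b → a ≡ b
T-injective a⇔b = ⇔→≡ {z = true} (⇔-trans (⇔-sym T-≡) (⇔-trans a⇔b T-≡))

∈-tabulate⇔ : ∀ {h : Fin n → Bool} {x} → x ∈ tabulate h ⇔ T (h x)
∈-tabulate⇔ {h = h} {x} = mk⇔
  (λ x∈ → from T-≡ (trans (sym (Vec.lookup∘tabulate h x)) (Vec.[]=⇒lookup x∈)))
  (λ hx → Vec.lookup⇒[]= x (tabulate h) (trans (Vec.lookup∘tabulate h x) (to T-≡ hx)))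

-- Counting subsets

module _ {A : Set} where

  length-─ : ∀ (ys : List A) {x} (x∈ys : x ∈ˡ ys) → suc (length (ys Any.─ x∈ys)) ≡ length ys
  length-─ (y ∷ ys) (Any.here _)     = refl
  length-─ (y ∷ ys) (Any.there x∈ys) = cong suc (length-─ ys x∈ys)

  ∈-─ : ∀ (ys : List A) {x z} (x∈ys : x ∈ˡ ys) → z ∈ˡ ys → z ≢ x → z ∈ˡ (ys Any.─ x∈ys)
  ∈-─ (y ∷ ys) (Any.here refl)  (Any.here refl)  z≢x = ⊥-elim (z≢x refl)
  ∈-─ (y ∷ ys) (Any.here _)     (Any.there z∈ys) _   = z∈ys
  ∈-─ (y ∷ ys) (Any.there _)    (Any.here z≡y)   _   = Any.here z≡y
  ∈-─ (y ∷ ys) (Any.there x∈ys) (Any.there z∈ys) z≢x = Any.there (∈-─ ys x∈ys z∈ys z≢x)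

  unique-⊆⇒length-≤ : ∀ {xs ys : List A} → Unique xs → (∀ {z} → z ∈ˡ xs → z ∈ˡ ys) →
                      length xs ≤ length ys
  unique-⊆⇒length-≤ {[]}     _                _     = z≤n
  unique-⊆⇒length-≤ {x ∷ xs} {ys} (x∉xs ∷ !xs) xs⊆ys =
    subst (suc (length xs) ≤_) (length-─ ys x∈ys)
      (s≤s (unique-⊆⇒length-≤ !xs λ z∈xs →
        ∈-─ ys x∈ys (xs⊆ys (Any.there z∈xs)) (λ { refl → All.lookup x∉xs z∈xs refl })))
    where
    x∈ys = xs⊆ys (Any.here refl)

∈-allSubsets : ∀ (p : Subset n) → p ∈ˡ allSubsets n
∈-allSubsets []          = Any.here refl
∈-allSubsets (true ∷ p)  = ∈-++⁺ˡ (∈-map⁺ (true ∷_) (∈-allSubsets p))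
∈-allSubsets {suc n} (false ∷ p) =
  ∈-++⁺ʳ (map (true ∷_) (allSubsets n)) (∈-map⁺ (false ∷_) (∈-allSubsets p))

allSubsets-unique : ∀ n → Unique (allSubsets n)
allSubsets-unique zero    = [] ∷ []
allSubsets-unique (suc n) =
  Unique.++⁺ (Unique.map⁺ ∷-injectiveʳ (allSubsets-unique n))
             (Unique.map⁺ ∷-injectiveʳ (allSubsets-unique n)) disjoint
  where
  ∷-injectiveʳ : ∀ {b} {p q : Subset n} → (Subset (suc n) ∋ b ∷ p) ≡ b ∷ q → p ≡ q
  ∷-injectiveʳ refl = refl
  disjoint : ∀ {p} → ¬ (p ∈ˡ map (true ∷_) (allSubsets n) × p ∈ˡ map (false ∷_) (allSubsets n))
  disjoint (p∈ , p∈′) with ∈-map⁻ (true ∷_) p∈ | ∈-map⁻ (false ∷_) p∈′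
  ... | _ , _ , refl | _ , _ , ()

count : (Subset n → Bool) → ℕ
count {n} p = length (filterᵇ p (allSubsets n))

∈-filter-allSubsets⇔ : ∀ {p : Subset n → Bool} {x} → x ∈ˡ filterᵇ p (allSubsets n) ⇔ T (p x)
∈-filter-allSubsets⇔ {n} {p = p} {x} =
  mk⇔ (proj₂ ∘ ∈-filter⁻ (T? ∘ p) {xs = allSubsets n}) (∈-filter⁺ (T? ∘ p) (∈-allSubsets x))

count-surjection : ∀ (p q : Subset n → Bool) (φ : Subset n → Subset n) →
                   (∀ y → T (q y) → ∃ λ x → T (p x) × φ x ≡ y) → count q ≤ count p
count-surjection {n} p q φ onto =
  subst (count q ≤_) (length-map φ (filterᵇ p (allSubsets n)))
    (unique-⊆⇒length-≤ (Unique.filter⁺ (T? ∘ q) (allSubsets-unique n)) covered)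
  where
  covered : ∀ {y} → y ∈ˡ filterᵇ q (allSubsets n) → y ∈ˡ map φ (filterᵇ p (allSubsets n))
  covered y∈ with onto _ (to ∈-filter-allSubsets⇔ y∈)
  ... | x , px , refl = ∈-map⁺ φ (from ∈-filter-allSubsets⇔ px)

count-injection : ∀ (p q : Subset n → Bool) (φ : Subset n → Subset n) →
                  (∀ x → T (p x) → T (q (φ x))) →
                  (∀ x y → T (p x) → T (p y) → φ x ≡ φ y → x ≡ y) → count p ≤ count q
count-injection {n} p q φ into injective =
  subst (_≤ count q) (length-map φ ps)
    (unique-⊆⇒length-≤ (map-unique ps (All.tabulate (to ∈-filter-allSubsets⇔))
                                       (Unique.filter⁺ (T? ∘ p) (allSubsets-unique n)))
                        inside)
  where
  ps = filterᵇ p (allSubsets n)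
  map-unique : ∀ xs → All (T ∘ p) xs → Unique xs → Unique (map φ xs)
  map-unique []       []         []           = []
  map-unique (x ∷ xs) (px ∷ pxs) (x∉xs ∷ !xs) = fresh xs pxs x∉xs ∷ map-unique xs pxs !xs
    where
    fresh : ∀ ys → All (T ∘ p) ys → All (x ≢_) ys → All (φ x ≢_) (map φ ys)
    fresh []       []         []           = []
    fresh (y ∷ ys) (py ∷ pys) (x≢y ∷ x∉ys) = (x≢y ∘ injective x y px py) ∷ fresh ys pys x∉ys
  inside : ∀ {z} → z ∈ˡ map φ ps → z ∈ˡ filterᵇ q (allSubsets n)
  inside z∈ with ∈-map⁻ φ z∈
  ... | x , x∈ , refl = from ∈-filter-allSubsets⇔ (into x (to ∈-filter-allSubsets⇔ x∈))

count-bijection : ∀ (p q : Subset n → Bool) (φ : Subset n → Subset n) →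
                  (∀ x → T (p x) → T (q (φ x))) →
                  (∀ x y → T (p x) → T (p y) → φ x ≡ φ y → x ≡ y) →
                  (∀ y → T (q y) → ∃ λ x → T (p x) × φ x ≡ y) → count p ≡ count q
count-bijection p q φ into injective onto =
  ℕ.≤-antisym (count-injection p q φ into injective) (count-surjection p q φ onto)

count-cong : ∀ {p q : Subset n → Bool} → (∀ x → p x ≡ q x) → count p ≡ count q
count-cong {n} {p} {q} p≗q =
  cong length (filter-≐ (T? ∘ p) (T? ∘ q) (subst T (p≗q _) , subst T (sym (p≗q _))) (allSubsets n))

count-split : ∀ (p q : Subset n → Bool) →
              count p ≡ count (λ x → p x ∧ q x) + count (λ x → p x ∧ not (q x))
count-split {n} p q = split (allSubsets n)
  where
  split : ∀ xs → length (filterᵇ p xs) ≡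
                 length (filterᵇ (λ x → p x ∧ q x) xs) + length (filterᵇ (λ x → p x ∧ not (q x)) xs)
  split []       = refl
  split (x ∷ xs) with p x | q x
  ... | true  | true  = cong suc (split xs)
  ... | true  | false = trans (cong suc (split xs)) (sym (ℕ.+-suc _ _))
  ... | false | _     = split xs

count-none : ∀ (p : Subset n → Bool) → (∀ x → ¬ T (p x)) → count p ≡ 0
count-none {n} p none = cong length (filter-none (T? ∘ p) (All.tabulate {xs = allSubsets n} (λ _ → none _)))

count-some : ∀ (p : Subset n → Bool) {x} → T (p x) → 0 < count p
count-some p {x} px = filter-some (T? ∘ p) (Any.map (λ { refl → px }) (∈-allSubsets x))

count-<-collapsing : ∀ (p q : Subset n → Bool) (φ : Subset n → Subset n) →
                     (∀ y → T (q y) → ∃ λ x → T (p x) × φ x ≡ y) →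
                     ∀ {x y} → T (p x) → T (p y) → x ≢ y → φ x ≡ φ y → count q < count p
count-<-collapsing p q φ onto {x} {y} px py x≢y φx≡φy = begin-strict
  count q                  ≤⟨ count-surjection p-y q φ onto-y ⟩
  count p-y                <⟨ ℕ.m<n+m (count p-y) (count-some p=y (from T-∧ (py , y≡ˢy))) ⟩
  count p=y + count p-y    ≡⟨ count-split p (_≡ˢ y) ⟨
  count p                  ∎
  where
  open ℕ.≤-Reasoning
  p=y p-y : Subset _ → Bool
  p=y z = p z ∧ (z ≡ˢ y)
  p-y z = p z ∧ not (z ≡ˢ y)
  y≡ˢy : T (y ≡ˢ y)
  y≡ˢy = from ≡ˢ⇔ refl
  onto-y : ∀ z → T (q z) → ∃ λ w → T (p-y w) × φ w ≡ z
  onto-y z qz with onto z qz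
  ... | w , pw , φw≡z with Vec.≡-dec Bool._≟_ w y
  ...   | yes refl = x , from T-∧ (px , from T-not⇔ (x≢y ∘ to ≡ˢ⇔)) , trans φx≡φy φw≡z
  ...   | no w≢y   = w , from T-∧ (pw , from T-not⇔ (w≢y ∘ to ≡ˢ⇔)) , φw≡z

≤-foldr-⊔ : ∀ {x} {xs : List ℕ} → x ∈ˡ xs → x ≤ foldr _⊔_ 0 xs
≤-foldr-⊔ (Any.here refl)  = ℕ.m≤m⊔n _ _
≤-foldr-⊔ (Any.there x∈xs) = ℕ.≤-trans (≤-foldr-⊔ x∈xs) (ℕ.m≤n⊔m _ _)

module _ (M : MatroidData n) where

  Indep : Subset n → Set
  Indep X = T (Ind M X)

  private
    independentSubsetsOf : Subset n → Subset n → Bool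
    independentSubsetsOf X Y = (Y ⊆ᵇ X) ∧ Ind M Y

  indep⇒≤rank : ∀ {X Y} → Y ⊆ X → Indep Y → ∣ Y ∣ ≤ rank M X
  indep⇒≤rank {X} {Y} Y⊆X indepY =
    ≤-foldr-⊔ (∈-map⁺ ∣_∣ (from (∈-filter-allSubsets⇔ {p = independentSubsetsOf X})
                                 (from (T-∧ {Y ⊆ᵇ X}) (⊆ᵇ⁺ Y⊆X , indepY))))

  rank-witness : Indep ∅ → ∀ X → ∃ λ Y → Y ⊆ X × Indep Y × ∣ Y ∣ ≡ rank M X
  rank-witness indep∅ X
    with foldr-selective ℕ.⊔-sel 0 (map ∣_∣ (filterᵇ (independentSubsetsOf X) (allSubsets n)))
  ... | inj₁ rank≡0 = ∅ , (λ x∈∅ → ⊥-elim (∉⊥ x∈∅)) , indep∅ , trans (∣⊥∣≡0 n) (sym rank≡0)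
  ... | inj₂ rank∈  with ∈-map⁻ ∣_∣ rank∈
  ...   | Y , Y∈ , rank≡∣Y∣ with to T-∧ (to ∈-filter-allSubsets⇔ Y∈)
  ...     | Y⊆X , indepY = Y , ⊆ᵇ⁻ Y⊆X , indepY , sym rank≡∣Y∣

  ∈cl⇔ : ∀ {X e} → e ∈ cl M X ⇔ (e ∈ E M × rank M (⁅ e ⁆ ∪ X) ≡ rank M X)
  ∈cl⇔ = mk⇔
    (λ e∈ → let e∈E , eq = to T-∧ (to ∈-tabulate⇔ e∈) in to ∈ᵇ⇔ e∈E , ℕ.≡ᵇ⇒≡ _ _ eq)
    (λ (e∈E , eq) → from ∈-tabulate⇔ (from T-∧ (from ∈ᵇ⇔ e∈E , ℕ.≡⇒≡ᵇ _ _ eq)))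

  ∈cl⇒∈E : ∀ {X e} → e ∈ cl M X → e ∈ E M
  ∈cl⇒∈E = proj₁ ∘ to ∈cl⇔

  isFlat⁺ : ∀ {F} → F ⊆ E M → cl M F ≡ F → T (isFlat M F)
  isFlat⁺ {F} F⊆E closed = from (T-∧ {F ⊆ᵇ E M}) (⊆ᵇ⁺ F⊆E , from ≡ˢ⇔ closed)

  isFlat⇒⊆E : ∀ {F} → T (isFlat M F) → F ⊆ E M
  isFlat⇒⊆E = ⊆ᵇ⁻ ∘ proj₁ ∘ to T-∧

  isFlat⇒closed : ∀ {F} → T (isFlat M F) → cl M F ≡ F
  isFlat⇒closed = to ≡ˢ⇔ ∘ proj₂ ∘ to T-∧

  private
    removalIndepᵇ : Subset n → Fin n → Bool
    removalIndepᵇ C e = not (e ∈ᵇ C) ∨ Ind M (C - e)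

  isCircuit⁺ : ∀ {C} → C ⊆ E M → ¬ Indep C → (∀ e → e ∈ C → Indep (C - e)) → T (isCircuit M C)
  isCircuit⁺ {C} C⊆E dependent minimal =
    from (T-∧ {C ⊆ᵇ E M}) (⊆ᵇ⁺ C⊆E , from (T-∧ {not (Ind M C)}) (from T-not⇔ dependent ,
      from (T-allᵇ⇔ {xs = allFin n}) (All.tabulate λ {e} _ → from T-implies⇔ (minimal e ∘ to ∈ᵇ⇔))))

  isCircuit⇒⊆E : ∀ {C} → T (isCircuit M C) → C ⊆ E M
  isCircuit⇒⊆E {C} t = ⊆ᵇ⁻ (proj₁ (to (T-∧ {C ⊆ᵇ E M}) t))

  isCircuit⇒dependent : ∀ {C} → T (isCircuit M C) → ¬ Indep C
  isCircuit⇒dependent {C} t =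
    to T-not⇔ (proj₁ (to (T-∧ {not (Ind M C)}) (proj₂ (to (T-∧ {C ⊆ᵇ E M}) t))))

  isCircuit⇒minimal : ∀ {C} → T (isCircuit M C) → ∀ e → e ∈ C → Indep (C - e)
  isCircuit⇒minimal {C} t e e∈C = to T-implies⇔ (All.lookup removable (∈-allFin e)) (from ∈ᵇ⇔ e∈C)
    where
    removable : All (T ∘ removalIndepᵇ C) (allFin n)
    removable = to T-allᵇ⇔ (proj₂ (to (T-∧ {not (Ind M C)}) (proj₂ (to (T-∧ {C ⊆ᵇ E M}) t))))

∈parallelSet⇔ : ∀ {N : MatroidData n} {f g e} →
                e ∈ parallelSet N f g ⇔ (e ∈ E N × e ∉ ⁅ f ⁆ ∪ ⁅ g ⁆ × T (isCircuit N (⁅ e ⁆ ∪ ⁅ g ⁆)))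
∈parallelSet⇔ {N = N} {f} {g} {e} = ⇔-trans ∈-tabulate⇔ (mk⇔
  (λ t → let e∈E , rest = to (T-∧ {e ∈ᵇ E N}) t ; e∉fg , circuit = to T-∧ rest in
    to ∈ᵇ⇔ e∈E , (to T-not⇔ e∉fg ∘ from ∈ᵇ⇔) , circuit)
  (λ (e∈E , e∉fg , circuit) →
    from (T-∧ {e ∈ᵇ E N}) (from ∈ᵇ⇔ e∈E , from T-∧ (from T-not⇔ (e∉fg ∘ to ∈ᵇ⇔) , circuit))))

isCircuit-cong : ∀ {M N : MatroidData n} {C} → E M ≡ E N → (∀ X → X ⊆ C → Ind M X ≡ Ind N X) →
                 isCircuit M C ≡ isCircuit N C
isCircuit-cong {C = C} E≡ Ind≡ = T-injective (mk⇔ (transfer E≡ Ind≡) (transfer (sym E≡) (λ X → sym ∘ Ind≡ X)))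
  where
  transfer : ∀ {M N} → E M ≡ E N → (∀ X → X ⊆ C → Ind M X ≡ Ind N X) → T (isCircuit M C) → T (isCircuit N C)
  transfer {M} {N} E≡ Ind≡ circuit =
    isCircuit⁺ N (subst (C ⊆_) E≡ (isCircuit⇒⊆E M circuit))
      (isCircuit⇒dependent M circuit ∘ subst T (sym (Ind≡ C id)))
      (λ e e∈C → subst T (Ind≡ (C - e) (p-y⊆p C e)) (isCircuit⇒minimal M circuit e e∈C))

parallelSet-cong : ∀ {M N : MatroidData n} {f g} → E M ≡ E N → (∀ X → ∣ X ∣ ≤ 2 → Ind M X ≡ Ind N X) →
                   parallelSet M f g ≡ parallelSet N f g
parallelSet-cong {f = f} {g} E≡ Ind≡ = Vec.tabulate-cong λ e →
  cong₂ (λ A c → (e ∈ᵇ A) ∧ not (e ∈ᵇ (⁅ f ⁆ ∪ ⁅ g ⁆)) ∧ c) E≡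
        (isCircuit-cong {C = ⁅ e ⁆ ∪ ⁅ g ⁆} E≡ λ X X⊆ → Ind≡ X (ℕ.≤-trans (p⊆q⇒∣p∣≤∣q∣ X⊆) (pair-size e)))
  where
  pair-size : ∀ e → ∣ ⁅ e ⁆ ∪ ⁅ g ⁆ ∣ ≤ 2
  pair-size e = subst (λ m → ∣ ⁅ e ⁆ ∪ ⁅ g ⁆ ∣ ≤ suc m) (∣⁅x⁆∣≡1 g) (∣⁅x⁆∪p∣≤ e ⁅ g ⁆)

-- Bases, closure and flats

module Matroid {M : MatroidData n} (isM : IsMatroid M) where
  open IsMatroid isM

  record IsBasis (B X : Subset n) : Set where
    constructor mkBasis
    field
      ⊆set  : B ⊆ X
      indep : Indep M B
      card  : ∣ B ∣ ≡ rank M X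

  open IsBasis public

  indep⇒⊆E : ∀ {X} → Indep M X → X ⊆ E M
  indep⇒⊆E = ind⊆E _

  indep-⊆ : ∀ {X Y} → X ⊆ Y → Indep M Y → Indep M X
  indep-⊆ = ind-sub _ _

  dependent-⊇ : ∀ {X Y} → X ⊆ Y → ¬ Indep M X → ¬ Indep M Y
  dependent-⊇ X⊆Y depX = depX ∘ indep-⊆ X⊆Y

  basis-exists : ∀ X → ∃ λ B → IsBasis B X
  basis-exists X with rank-witness M ind-∅ X
  ... | B , B⊆X , indepB , ∣B∣≡r = B , mkBasis B⊆X indepB ∣B∣≡r

  augment : ∀ {I X} → Indep M I → I ⊆ X → ∣ I ∣ < rank M X →
            ∃ λ y → y ∈ X × y ∉ I × Indep M (⁅ y ⁆ ∪ I)
  augment {I} {X} indepI I⊆X ∣I∣<r with basis-exists X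
  ... | B , mkBasis B⊆X indepB ∣B∣≡r with ind-aug I B indepI indepB (subst (∣ I ∣ <_) (sym ∣B∣≡r) ∣I∣<r)
  ...   | y , y∈B , y∉I , indep = y , B⊆X y∈B , y∉I , indep

  extend-to-size : ∀ {I X m} → Indep M I → I ⊆ X → ∣ I ∣ ≤ m → m ≤ rank M X →
                   ∃ λ Z → I ⊆ Z × Z ⊆ X × Indep M Z × ∣ Z ∣ ≡ m
  extend-to-size {I} {m = m} indepI I⊆X ∣I∣≤m =
    extend (m ∸ ∣ I ∣) indepI I⊆X (ℕ.m+[n∸m]≡n ∣I∣≤m)
    where
    extend : ∀ d {I X m} → Indep M I → I ⊆ X → ∣ I ∣ + d ≡ m → m ≤ rank M X →
             ∃ λ Z → I ⊆ Z × Z ⊆ X × Indep M Z × ∣ Z ∣ ≡ m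
    extend zero    {I} indepI I⊆X refl _ = I , id , I⊆X , indepI , sym (ℕ.+-identityʳ _)
    extend (suc d) {I} indepI I⊆X refl m≤r
      with augment indepI I⊆X (ℕ.<-≤-trans (ℕ.m<m+n _ z<s) m≤r)
    ... | y , y∈X , y∉I , indep with extend d indep (⁅y⁆∪p⊆q y∈X I⊆X) size m≤r
      where
      size : ∣ ⁅ y ⁆ ∪ I ∣ + d ≡ ∣ I ∣ + suc d
      size = trans (cong (_+ d) (∣⁅x⁆∪p∣ y I y∉I)) (sym (ℕ.+-suc ∣ I ∣ d))
    ...   | Z , ⁅y⁆∪I⊆Z , rest = Z , ⁅y⁆∪I⊆Z ∘ p⊆⁅y⁆∪p y I , rest

  extend-to-basis : ∀ {I X} → Indep M I → I ⊆ X → ∃ λ B → I ⊆ B × IsBasis B X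
  extend-to-basis indepI I⊆X with extend-to-size indepI I⊆X (indep⇒≤rank M I⊆X indepI) ℕ.≤-refl
  ... | B , I⊆B , B⊆X , indepB , ∣B∣≡r = B , I⊆B , mkBasis B⊆X indepB ∣B∣≡r

  insert-indep⇒<rank : ∀ {B Y e} → e ∉ B → ⁅ e ⁆ ∪ B ⊆ Y → Indep M (⁅ e ⁆ ∪ B) → ∣ B ∣ < rank M Y
  insert-indep⇒<rank {B} {e = e} e∉B ⊆Y indep = subst (_≤ _) (∣⁅x⁆∪p∣ e B e∉B) (indep⇒≤rank M ⊆Y indep)

  basis-maximal : ∀ {B X e} → IsBasis B X → e ∈ X → e ∉ B → ¬ Indep M (⁅ e ⁆ ∪ B)
  basis-maximal (mkBasis B⊆X _ ∣B∣≡r) e∈X e∉B =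
    ℕ.<-irrefl ∣B∣≡r ∘ insert-indep⇒<rank e∉B (⁅y⁆∪p⊆q e∈X B⊆X)

  maximal⇒basis : ∀ {B X} → B ⊆ X → Indep M B →
                  (∀ e → e ∈ X → e ∉ B → ¬ Indep M (⁅ e ⁆ ∪ B)) → IsBasis B X
  maximal⇒basis {B} {X} B⊆X indepB maximal with ∣ B ∣ ℕ.<? rank M X
  ... | yes ∣B∣<r = let e , e∈X , e∉B , indep = augment indepB B⊆X ∣B∣<r in
                    ⊥-elim (maximal e e∈X e∉B indep)
  ... | no ∣B∣≮r  = mkBasis B⊆X indepB (ℕ.≤-antisym (indep⇒≤rank M B⊆X indepB) (ℕ.≮⇒≥ ∣B∣≮r))

  indep⇒basis : ∀ {I} → Indep M I → IsBasis I I
  indep⇒basis indepI = maximal⇒basis id indepI (λ _ e∈I e∉I _ → e∉I e∈I)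

  rank-mono : ∀ {X Y} → X ⊆ Y → rank M X ≤ rank M Y
  rank-mono X⊆Y with basis-exists _
  ... | B , mkBasis B⊆X indepB ∣B∣≡r = subst (_≤ _) ∣B∣≡r (indep⇒≤rank M (X⊆Y ∘ B⊆X) indepB)

  basis⇒∈cl : ∀ {B X e} → IsBasis B X → e ∈ E M → e ∈ B ⊎ ¬ Indep M (⁅ e ⁆ ∪ B) → e ∈ cl M X
  basis⇒∈cl {B} {X} {e} basis@(mkBasis B⊆X indepB ∣B∣≡r) e∈E spanned =
    from (∈cl⇔ M) (e∈E , ℕ.≤-antisym (ℕ.≮⇒≥ no-growth) (rank-mono (p⊆⁅y⁆∪p e X)))
    where
    no-growth : ¬ rank M X < rank M (⁅ e ⁆ ∪ X)
    no-growth r<r′ with augment indepB (p⊆⁅y⁆∪p e X ∘ B⊆X) (subst (_< _) (sym ∣B∣≡r) r<r′)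
    ... | x , x∈ , x∉B , indep with x∈⁅y⁆∪p⁻ e X x∈
    ...   | inj₂ x∈X  = basis-maximal basis x∈X x∉B indep
    ...   | inj₁ refl = [ x∉B , (λ dependent → dependent indep) ]′ spanned

  basis⇒dependent : ∀ {B X e} → IsBasis B X → e ∈ cl M X → e ∉ B → ¬ Indep M (⁅ e ⁆ ∪ B)
  basis⇒dependent {e = e} (mkBasis B⊆X _ ∣B∣≡r) e∈cl e∉B =
    ℕ.<-irrefl (trans ∣B∣≡r (sym (proj₂ (to (∈cl⇔ M) e∈cl)))) ∘ insert-indep⇒<rank e∉B (⁅y⁆∪-mono e B⊆X)

  dependent⇒∈cl : ∀ {I e} → Indep M I → e ∈ E M → ¬ Indep M (⁅ e ⁆ ∪ I) → e ∈ cl M I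
  dependent⇒∈cl indepI e∈E dependent = basis⇒∈cl (indep⇒basis indepI) e∈E (inj₂ dependent)

  ∈cl⇒dependent : ∀ {I e} → Indep M I → e ∈ cl M I → e ∉ I → ¬ Indep M (⁅ e ⁆ ∪ I)
  ∈cl⇒dependent indepI = basis⇒dependent (indep⇒basis indepI)

  ∉cl⇒indep : ∀ {I e} → Indep M I → e ∈ E M → e ∉ cl M I → Indep M (⁅ e ⁆ ∪ I)
  ∉cl⇒indep {I} {e} indepI e∈E e∉cl =
    decidable-stable (T? (Ind M (⁅ e ⁆ ∪ I))) (e∉cl ∘ dependent⇒∈cl indepI e∈E)

  indep⇒∉cl-rest : ∀ {Z b} → Indep M Z → b ∈ Z → b ∉ cl M (Z - b)
  indep⇒∉cl-rest {Z} {b} indepZ b∈Z b∈cl =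
    ∈cl⇒dependent (indep-⊆ (p-y⊆p Z b) indepZ) b∈cl (y∉p-y Z b) (subst (Indep M) (sym (⁅x⁆∪[p-x] b∈Z)) indepZ)

  ⊆cl : ∀ {X} → X ⊆ E M → X ⊆ cl M X
  ⊆cl {X} X⊆E {e} e∈X with basis-exists X
  ... | B , basis with e ∈? B
  ...   | yes e∈B = basis⇒∈cl basis (X⊆E e∈X) (inj₁ e∈B)
  ...   | no e∉B  = basis⇒∈cl basis (X⊆E e∈X) (inj₂ (basis-maximal basis e∈X e∉B))

  cl-mono : ∀ {X Y} → X ⊆ Y → cl M X ⊆ cl M Y
  cl-mono {X} X⊆Y {e} e∈cl with basis-exists X
  ... | BX , basisX with extend-to-basis (indep basisX) (X⊆Y ∘ ⊆set basisX)
  ...   | BY , BX⊆BY , basisY with e ∈? BY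
  ...     | yes e∈BY = basis⇒∈cl basisY (∈cl⇒∈E M e∈cl) (inj₁ e∈BY)
  ...     | no e∉BY  = basis⇒∈cl basisY (∈cl⇒∈E M e∈cl)
                         (inj₂ (dependent-⊇ (⁅y⁆∪-mono e BX⊆BY) (basis⇒dependent basisX e∈cl (e∉BY ∘ BX⊆BY))))

  basis-cl : ∀ {B X} → IsBasis B X → IsBasis B (cl M X)
  basis-cl basis@(mkBasis _ indepB _) =
    maximal⇒basis (λ e∈B → basis⇒∈cl basis (indep⇒⊆E indepB e∈B) (inj₁ e∈B)) indepB
                  (λ _ → basis⇒dependent basis)

  cl-≡-common-basis : ∀ {B X Y} → IsBasis B X → IsBasis B Y → cl M X ≡ cl M Y
  cl-≡-common-basis basisX basisY = ⊆-antisym (transfer basisX basisY) (transfer basisY basisX)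
    where
    transfer : ∀ {B X Y} → IsBasis B X → IsBasis B Y → cl M X ⊆ cl M Y
    transfer {B} basisX basisY {e} e∈cl with e ∈? B
    ... | yes e∈B = basis⇒∈cl basisY (∈cl⇒∈E M e∈cl) (inj₁ e∈B)
    ... | no e∉B  = basis⇒∈cl basisY (∈cl⇒∈E M e∈cl) (inj₂ (basis⇒dependent basisX e∈cl e∉B))

  cl-idem : ∀ X → cl M (cl M X) ≡ cl M X
  cl-idem X = let _ , basis = basis-exists X in cl-≡-common-basis (basis-cl basis) basis

  cl-basis : ∀ {B X} → IsBasis B X → cl M B ≡ cl M X
  cl-basis basis = cl-≡-common-basis (indep⇒basis (indep basis)) basis

  cl-least : ∀ {X Y} → X ⊆ cl M Y → cl M X ⊆ cl M Y
  cl-least {Y = Y} X⊆clY = subst (_ ∈_) (cl-idem Y) ∘ cl-mono X⊆clY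

  rank-cl : ∀ X → rank M (cl M X) ≡ rank M X
  rank-cl X = let B , basis = basis-exists X in trans (sym (card (basis-cl basis))) (card basis)

  rank-indep : ∀ {I} → Indep M I → rank M I ≡ ∣ I ∣
  rank-indep indepI = sym (card (indep⇒basis indepI))

  cl-isFlat : ∀ X → T (isFlat M (cl M X))
  cl-isFlat X = isFlat⁺ M (∈cl⇒∈E M) (cl-idem X)

  cl⊆flat : ∀ {X F} → T (isFlat M F) → X ⊆ F → cl M X ⊆ F
  cl⊆flat {F = F} flatF X⊆F = subst (_ ∈_) (isFlat⇒closed M flatF) ∘ cl-mono X⊆F

  flat-⊆-rank-≡ : ∀ {F G} → T (isFlat M F) → T (isFlat M G) → F ⊆ G → rank M F ≡ rank M G → F ≡ G
  flat-⊆-rank-≡ {F} {G} flatF flatG F⊆G rank≡ with basis-exists F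
  ... | B , basis = begin
    F         ≡⟨ isFlat⇒closed M flatF ⟨
    cl M F    ≡⟨ cl-≡-common-basis basis (mkBasis (F⊆G ∘ ⊆set basis) (indep basis) (trans (card basis) rank≡)) ⟩
    cl M G    ≡⟨ isFlat⇒closed M flatG ⟩
    G         ∎
    where open ≡-Reasoning

  loop∈cl : ∀ {e} X → e ∈ E M → ¬ Indep M ⁅ e ⁆ → e ∈ cl M X
  loop∈cl {e} X e∈E loop =
    basis⇒∈cl (proj₂ (basis-exists X)) e∈E (inj₂ (dependent-⊇ (p⊆p∪q _) loop))

  loop∈flat : ∀ {e F} → e ∈ E M → ¬ Indep M ⁅ e ⁆ → T (isFlat M F) → e ∈ F
  loop∈flat {F = F} e∈E loop flatF = subst (_ ∈_) (isFlat⇒closed M flatF) (loop∈cl F e∈E loop)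

  basis-insert-∈cl : ∀ {B X e} → IsBasis B X → e ∈ cl M X → IsBasis B (⁅ e ⁆ ∪ X)
  basis-insert-∈cl {B} {X} {e} basis e∈cl =
    maximal⇒basis (p⊆⁅y⁆∪p e X ∘ ⊆set basis) (indep basis) maximal
    where
    maximal : ∀ x → x ∈ ⁅ e ⁆ ∪ X → x ∉ B → ¬ Indep M (⁅ x ⁆ ∪ B)
    maximal x x∈ x∉B with x∈⁅y⁆∪p⁻ e X x∈
    ... | inj₁ refl = basis⇒dependent basis e∈cl x∉B
    ... | inj₂ x∈X  = basis-maximal basis x∈X x∉B

  basis-insert-∉cl : ∀ {B X e} → IsBasis B X → e ∈ E M → e ∉ cl M X → IsBasis (⁅ e ⁆ ∪ B) (⁅ e ⁆ ∪ X)
  basis-insert-∉cl {B} {X} {e} basis e∈E e∉cl =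
    maximal⇒basis (⁅y⁆∪-mono e (⊆set basis)) indep-e+B maximal
    where
    indep-e+B : Indep M (⁅ e ⁆ ∪ B)
    indep-e+B = ∉cl⇒indep (indep basis) e∈E (e∉cl ∘ subst (e ∈_) (cl-basis basis))
    maximal : ∀ x → x ∈ ⁅ e ⁆ ∪ X → x ∉ ⁅ e ⁆ ∪ B → ¬ Indep M (⁅ x ⁆ ∪ (⁅ e ⁆ ∪ B))
    maximal x x∈ x∉ with x∈⁅y⁆∪p⁻ e X x∈
    ... | inj₁ refl = ⊥-elim (x∉ (y∈⁅y⁆∪p e B))
    ... | inj₂ x∈X  = dependent-⊇ (⁅y⁆∪-mono x (p⊆⁅y⁆∪p e B))
                                  (basis-maximal basis x∈X (x∉ ∘ p⊆⁅y⁆∪p e B))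

  cl-insert-∈cl : ∀ {X e} → e ∈ cl M X → cl M (⁅ e ⁆ ∪ X) ≡ cl M X
  cl-insert-∈cl e∈cl =
    let _ , basis = basis-exists _ in cl-≡-common-basis (basis-insert-∈cl basis e∈cl) basis

  rank-insert-∉cl : ∀ {X e} → e ∈ E M → e ∉ cl M X → rank M (⁅ e ⁆ ∪ X) ≡ suc (rank M X)
  rank-insert-∉cl {X} {e} e∈E e∉cl with basis-exists X
  ... | B , basis = begin
    rank M (⁅ e ⁆ ∪ X)  ≡⟨ card (basis-insert-∉cl basis e∈E e∉cl) ⟨
    ∣ ⁅ e ⁆ ∪ B ∣       ≡⟨ ∣⁅x⁆∪p∣ e B (e∉cl ∘ ⊆set (basis-cl basis)) ⟩
    suc ∣ B ∣           ≡⟨ cong suc (card basis) ⟩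
    suc (rank M X)      ∎
    where open ≡-Reasoning

  cl-exchange : ∀ {X e f} → e ∉ cl M X → f ∈ E M → e ∈ cl M (⁅ f ⁆ ∪ X) → f ∈ cl M (⁅ e ⁆ ∪ X)
  cl-exchange {X} {e} {f} e∉cl f∈E e∈cl with e ≟ f | f ∈? cl M (⁅ e ⁆ ∪ X) | basis-exists X
  ... | yes refl | _        | _         = e∈cl
  ... | no _     | yes f∈cl | _         = f∈cl
  ... | no e≢f   | no f∉cl  | B , basis = ⊥-elim (basis⇒dependent basis-f e∈cl e∉f+B indep-e+f+B)
    where
    f∉clX : f ∉ cl M X
    f∉clX f∈clX = e∉cl (subst (e ∈_) (cl-insert-∈cl f∈clX) e∈cl)
    basis-f : IsBasis (⁅ f ⁆ ∪ B) (⁅ f ⁆ ∪ X)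
    basis-f = basis-insert-∉cl basis f∈E f∉clX
    e∉f+B : e ∉ ⁅ f ⁆ ∪ B
    e∉f+B = x∉⁅y⁆∪p e≢f (e∉cl ∘ ⊆set (basis-cl basis))
    indep-e+f+B : Indep M (⁅ e ⁆ ∪ (⁅ f ⁆ ∪ B))
    indep-e+f+B = subst (Indep M) (⁅x⁆∪⁅y⁆∪p-comm f e B)
      (indep (basis-insert-∉cl (basis-insert-∉cl basis (∈cl⇒∈E M e∈cl) e∉cl) f∈E f∉cl))

  nonloop-avoiding-flat : ∀ {e k} → Indep M ⁅ e ⁆ → suc k ≤ rk M →
                          ∃ λ F → T (isFlat M F) × rank M F ≡ k × e ∉ F
  nonloop-avoiding-flat {e} {k} indep-e k<r
    with extend-to-size indep-e (indep⇒⊆E indep-e) (ℕ.≤-trans (ℕ.≤-reflexive (∣⁅x⁆∣≡1 e)) (s≤s z≤n)) k<r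
  ... | Z , ⁅e⁆⊆Z , _ , indepZ , ∣Z∣≡1+k = cl M (Z - e) , cl-isFlat _ , rank≡k , e∉cl
    where
    e∈Z = ⁅e⁆⊆Z (x∈⁅x⁆ e)
    indepZ-e = indep-⊆ (p-y⊆p Z e) indepZ
    rank≡k : rank M (cl M (Z - e)) ≡ k
    rank≡k = trans (rank-cl (Z - e))
                   (trans (rank-indep indepZ-e) (ℕ.suc-injective (trans (∣p-x∣ Z e e∈Z) ∣Z∣≡1+k)))
    e∉cl : e ∉ cl M (Z - e)
    e∉cl = indep⇒∉cl-rest indepZ e∈Z

  circuit-through : ∀ {I e} → Indep M I → e ∈ E M → ¬ Indep M (⁅ e ⁆ ∪ I) →
                    ∃ λ C → C ⊆ ⁅ e ⁆ ∪ I × e ∈ C × T (isCircuit M C)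
  circuit-through {I} {e} indepI e∈E dependent =
    shrink ∣ ⁅ e ⁆ ∪ I ∣ ℕ.≤-refl (y∈⁅y⁆∪p e I) (indep-⊆ ⊆I indepI) dependent
           (⁅y⁆∪p⊆q e∈E (indep⇒⊆E indepI))
    where
    ⊆I : (⁅ e ⁆ ∪ I) - e ⊆ I
    ⊆I x∈ with x∈p-y⁻ _ e x∈
    ... | x∈ , x≢e = [ (λ x≡e → ⊥-elim (x≢e x≡e)) , id ]′ (x∈⁅y⁆∪p⁻ e I x∈)
    shrink : ∀ m {S} → ∣ S ∣ ≤ m → e ∈ S → Indep M (S - e) → ¬ Indep M S → S ⊆ E M →
             ∃ λ C → C ⊆ S × e ∈ C × T (isCircuit M C)
    shrink m {S} ∣S∣≤m e∈S indepS-e depS S⊆E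
      with any? (λ b → b ∈? S ×-dec (¬? (b ≟ e) ×-dec ¬? (T? (Ind M (S - b)))))
    ... | no none = S , id , e∈S , isCircuit⁺ M S⊆E depS minimal
      where
      minimal : ∀ b → b ∈ S → Indep M (S - b)
      minimal b b∈S with b ≟ e | T? (Ind M (S - b))
      ... | yes refl | _          = indepS-e
      ... | no _     | yes indep  = indep
      ... | no b≢e   | no dep     = ⊥-elim (none (b , b∈S , b≢e , dep))
    shrink zero    ∣S∣≤0 _ _ _ _ | yes (b , b∈S , _) =
      ⊥-elim (ℕ.n≮0 (ℕ.<-≤-trans (x∈p⇒∣p-x∣<∣p∣ b∈S) ∣S∣≤0))
    shrink (suc m) {S} ∣S∣≤m e∈S indepS-e _ S⊆E | yes (b , b∈S , b≢e , depS-b)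
      with shrink m (ℕ.≤-pred (ℕ.<-≤-trans (x∈p⇒∣p-x∣<∣p∣ b∈S) ∣S∣≤m))
                    (x∈p∧x≢y⇒x∈p-y e∈S (b≢e ∘ sym)) (indep-⊆ (-y-mono e (p-y⊆p S b)) indepS-e)
                    depS-b (S⊆E ∘ p-y⊆p S b)
    ... | C , C⊆S-b , rest = C , p-y⊆p S b ∘ C⊆S-b , rest

  circuit-∈cl : ∀ {C b} → T (isCircuit M C) → b ∈ C → b ∈ cl M (C - b)
  circuit-∈cl {C} {b} circuit b∈C =
    dependent⇒∈cl (isCircuit⇒minimal M circuit b b∈C) (isCircuit⇒⊆E M circuit b∈C)
      (subst (λ Z → ¬ Indep M Z) (sym (⁅x⁆∪[p-x] b∈C)) (isCircuit⇒dependent M circuit))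

  pair-isCircuit⇔ : ∀ {x y} → x ≢ y →
                    T (isCircuit M (⁅ x ⁆ ∪ ⁅ y ⁆)) ⇔
                    (Indep M ⁅ x ⁆ × Indep M ⁅ y ⁆ × ¬ Indep M (⁅ x ⁆ ∪ ⁅ y ⁆))
  pair-isCircuit⇔ {x} {y} x≢y = mk⇔
    (λ circuit → subst (Indep M) pair-y (isCircuit⇒minimal M circuit y (y∈pair)) ,
                 subst (Indep M) pair-x (isCircuit⇒minimal M circuit x (y∈⁅y⁆∪p x ⁅ y ⁆)) ,
                 isCircuit⇒dependent M circuit)
    (λ (indep-x , indep-y , dependent) →
      isCircuit⁺ M (⁅y⁆∪p⊆q (indep⇒⊆E indep-x (x∈⁅x⁆ x)) (indep⇒⊆E indep-y)) dependent
        λ z z∈ → [ (λ { refl → subst (Indep M) (sym pair-x) indep-y }) ,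
                   (λ z∈⁅y⁆ → subst (Indep M) (sym (trans (cong (_ -_) (x∈⁅y⁆⇒x≡y y z∈⁅y⁆)) pair-y)) indep-x) ]′
                 (x∈⁅y⁆∪p⁻ x ⁅ y ⁆ z∈))
    where
    y∈pair : y ∈ ⁅ x ⁆ ∪ ⁅ y ⁆
    y∈pair = p⊆⁅y⁆∪p x ⁅ y ⁆ (x∈⁅x⁆ y)
    pair-x : (⁅ x ⁆ ∪ ⁅ y ⁆) - x ≡ ⁅ y ⁆
    pair-x = [⁅x⁆∪p]-x (x≢y⇒x∉⁅y⁆ x≢y)
    pair-y : (⁅ x ⁆ ∪ ⁅ y ⁆) - y ≡ ⁅ x ⁆
    pair-y = trans (cong (_- y) (∪-comm ⁅ x ⁆ ⁅ y ⁆)) ([⁅x⁆∪p]-x (x≢y⇒x∉⁅y⁆ (x≢y ∘ sym)))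

  freer⇒∈cl : ∀ {f g X} → Freer M f g → f ∉ X → f ∈ cl M X → g ∈ cl M X
  freer⇒∈cl {f} {X = X} freer f∉X f∈cl with basis-exists X
  ... | B , basis
    with circuit-through (indep basis) (∈cl⇒∈E M f∈cl) (basis⇒dependent basis f∈cl (f∉X ∘ ⊆set basis))
  ...   | C , C⊆f+B , f∈C , circuit =
    cl-least (⁅y⁆∪p⊆q f∈cl (⊆set (basis-cl basis)) ∘ C⊆f+B) (freer C circuit f∈C)

-- Truncation

E-τ^ : ∀ {M : MatroidData n} i → E (τ^ i M) ≡ E M
E-τ^ zero    = refl
E-τ^ (suc i) = E-τ^ i

τ-Indep⇔ : ∀ {N : MatroidData n} {m} → rk N ≡ suc m → ∀ X → Indep (τ N) X ⇔ (Indep N X × ∣ X ∣ ≤ m)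
τ-Indep⇔ {N = N} {m} rk≡ X = mk⇔
  (λ t → let indepX , small = to T-∧ t in indepX , to bound (subst bounded rk≡ small))
  (λ (indepX , ∣X∣≤m) → from (T-∧ {Ind N X}) (indepX , subst bounded (sym rk≡) (from bound ∣X∣≤m)))
  where
  bounded : ℕ → Set
  bounded r = T ((∣ X ∣ <ᵇ r) ∨ (r ≡ᵇ 0))
  bound : bounded (suc m) ⇔ ∣ X ∣ ≤ m
  bound = mk⇔ (ℕ.≤-pred ∘ ℕ.<ᵇ⇒< _ _ ∘ subst T (∨-identityʳ _))
              (subst T (sym (∨-identityʳ _)) ∘ ℕ.<⇒<ᵇ ∘ s≤s)

module Truncation {M : MatroidData n} (isM : IsMatroid M) where
  open IsMatroid isM
  open Matroid isM

  rk-of-size-bounded : ∀ {N : MatroidData n} {m} → E N ≡ E M →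
                       (∀ X → Indep N X ⇔ (Indep M X × ∣ X ∣ ≤ m)) → m ≤ rk M → rk N ≡ m
  rk-of-size-bounded {N} {m} E≡ indep⇔ m≤r
    with rank-witness N (from (indep⇔ ∅) (ind-∅ , ∣∅∣≤ {n} m)) (E N)
       | extend-to-size ind-∅ (λ x∈∅ → ⊥-elim (∉⊥ x∈∅)) (∣∅∣≤ {n} m) m≤r
  ... | Y , _ , indepY , ∣Y∣≡rk | Z , _ , Z⊆E , indepZ , ∣Z∣≡m =
    ℕ.≤-antisym (subst (_≤ m) ∣Y∣≡rk (proj₂ (to (indep⇔ Y) indepY)))
                (subst (_≤ rk N) ∣Z∣≡m
                  (indep⇒≤rank N (subst (Z ⊆_) (sym E≡) Z⊆E) (from (indep⇔ Z) (indepZ , ℕ.≤-reflexive ∣Z∣≡m))))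

  τ^-Indep⇔ : ∀ i → i < rk M → ∀ X → Indep (τ^ i M) X ⇔ (Indep M X × ∣ X ∣ ≤ rk M ∸ i)
  τ^-Indep⇔ zero    _   X = mk⇔ (λ indepX → indepX , indep⇒≤rank M (indep⇒⊆E indepX) indepX) proj₁
  τ^-Indep⇔ (suc i) i<r X = ⇔-trans (τ-Indep⇔ rk≡ X) (mk⇔
    (λ (indepX , ∣X∣≤) → proj₁ (to (τ^-Indep⇔ i i<r′ X) indepX) , ∣X∣≤)
    (λ (indepX , ∣X∣≤) →
      from (τ^-Indep⇔ i i<r′ X) (indepX , ℕ.≤-trans ∣X∣≤ (ℕ.∸-monoʳ-≤ (rk M) (ℕ.n≤1+n i))) , ∣X∣≤))
    where
    i<r′ : i < rk M
    i<r′ = ℕ.<-trans (ℕ.n<1+n i) i<r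
    rk≡ : rk (τ^ i M) ≡ suc (rk M ∸ suc i)
    rk≡ = trans (rk-of-size-bounded (E-τ^ i) (τ^-Indep⇔ i i<r′) (ℕ.m∸n≤m _ i)) (ℕ.+-∸-assoc 1 i<r′)

-- Transpositions and clones

swapElt-view : ∀ (x y e : Fin n) → (e ≡ x × swapElt x y e ≡ y)
                                 ⊎ (e ≢ x × e ≡ y × swapElt x y e ≡ x)
                                 ⊎ (e ≢ x × e ≢ y × swapElt x y e ≡ e)
swapElt-view x y e with e ≟ x
... | yes e≡x = inj₁ (e≡x , refl)
... | no e≢x with e ≟ y
...   | yes e≡y = inj₂ (inj₁ (e≢x , e≡y , refl))
...   | no e≢y  = inj₂ (inj₂ (e≢x , e≢y , refl))

∈swapSet⇔ : ∀ {x y e} {X : Subset n} → e ∈ swapSet x y X ⇔ swapElt x y e ∈ X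
∈swapSet⇔ {x = x} {y} {e} {X} = mk⇔
  (λ e∈ → Vec.lookup⇒[]= _ X (trans (sym (Vec.lookup∘tabulate _ e)) (Vec.[]=⇒lookup e∈)))
  (λ e∈ → Vec.lookup⇒[]= e (swapSet x y X) (trans (Vec.lookup∘tabulate _ e) (Vec.[]=⇒lookup e∈)))

swapSet-fixes : ∀ {x y} {X : Subset n} → (x ∈ X → y ∈ X) → (y ∈ X → x ∈ X) → swapSet x y X ≡ X
swapSet-fixes {x = x} {y} {X} x⇒y y⇒x = ⊆-antisym forth back
  where
  forth : swapSet x y X ⊆ X
  forth {e} e∈ with swapElt-view x y e | to ∈swapSet⇔ e∈
  ... | inj₁ (refl , eq)               | e′∈ = y⇒x (subst (_∈ X) eq e′∈)
  ... | inj₂ (inj₁ (_ , refl , eq))    | e′∈ = x⇒y (subst (_∈ X) eq e′∈)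
  ... | inj₂ (inj₂ (_ , _ , eq))       | e′∈ = subst (_∈ X) eq e′∈
  back : X ⊆ swapSet x y X
  back {e} e∈X with swapElt-view x y e
  ... | inj₁ (refl , eq)            = from ∈swapSet⇔ (subst (_∈ X) (sym eq) (x⇒y e∈X))
  ... | inj₂ (inj₁ (_ , refl , eq)) = from ∈swapSet⇔ (subst (_∈ X) (sym eq) (y⇒x e∈X))
  ... | inj₂ (inj₂ (_ , _ , eq))    = from ∈swapSet⇔ (subst (_∈ X) (sym eq) e∈X)

swapSet-exchanges : ∀ {x y} {X : Subset n} → x ≢ y → x ∈ X → y ∉ X → swapSet x y X ≡ ⁅ y ⁆ ∪ (X - x)
swapSet-exchanges {x = x} {y} {X} x≢y x∈X y∉X = ⊆-antisym forth back
  where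
  forth : swapSet x y X ⊆ ⁅ y ⁆ ∪ (X - x)
  forth {e} e∈ with swapElt-view x y e | to ∈swapSet⇔ e∈
  ... | inj₁ (refl , eq)               | e′∈ = ⊥-elim (y∉X (subst (_∈ X) eq e′∈))
  ... | inj₂ (inj₁ (_ , refl , _))     | _   = y∈⁅y⁆∪p e _
  ... | inj₂ (inj₂ (e≢x , _ , eq))     | e′∈ = p⊆⁅y⁆∪p y _ (x∈p∧x≢y⇒x∈p-y (subst (_∈ X) eq e′∈) e≢x)
  back : ⁅ y ⁆ ∪ (X - x) ⊆ swapSet x y X
  back {e} e∈ with swapElt-view x y e | x∈⁅y⁆∪p⁻ y (X - x) e∈
  ... | inj₁ (refl , _)             | inj₁ refl = ⊥-elim (x≢y refl)
  ... | inj₁ (refl , _)             | inj₂ e∈′  = ⊥-elim (y∉p-y X e e∈′)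
  ... | inj₂ (inj₁ (_ , refl , eq)) | _         = from ∈swapSet⇔ (subst (_∈ X) (sym eq) x∈X)
  ... | inj₂ (inj₂ (_ , e≢y , _))   | inj₁ e≡y  = ⊥-elim (e≢y e≡y)
  ... | inj₂ (inj₂ (_ , _ , eq))    | inj₂ e∈′  = from ∈swapSet⇔ (subst (_∈ X) (sym eq) (p-y⊆p X x e∈′))

swapSet-comm : ∀ (x y : Fin n) X → swapSet x y X ≡ swapSet y x X
swapSet-comm x y X = Vec.tabulate-cong (λ e → cong (lookup X) (swapElt-comm e))
  where
  swapElt-comm : ∀ e → swapElt x y e ≡ swapElt y x e
  swapElt-comm e with swapElt-view x y e | swapElt-view y x e
  ... | inj₁ (refl , p)            | inj₁ (e≡y , q)            = trans p (trans (sym e≡y) (sym q))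
  ... | inj₁ (refl , p)            | inj₂ (inj₁ (_ , _ , q))   = trans p (sym q)
  ... | inj₁ (refl , _)            | inj₂ (inj₂ (_ , e≢x , _)) = ⊥-elim (e≢x refl)
  ... | inj₂ (inj₁ (_ , refl , p)) | inj₁ (_ , q)              = trans p (sym q)
  ... | inj₂ (inj₁ (_ , e≡y , _))  | inj₂ (inj₁ (e≢y , _))    = ⊥-elim (e≢y e≡y)
  ... | inj₂ (inj₁ (_ , e≡y , _))  | inj₂ (inj₂ (e≢y , _))    = ⊥-elim (e≢y e≡y)
  ... | inj₂ (inj₂ (_ , e≢y , _))  | inj₁ (e≡y , _)            = ⊥-elim (e≢y e≡y)
  ... | inj₂ (inj₂ (e≢x , _))      | inj₂ (inj₁ (_ , e≡x , _)) = ⊥-elim (e≢x e≡x)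
  ... | inj₂ (inj₂ (_ , _ , p))    | inj₂ (inj₂ (_ , _ , q))   = trans p (sym q)

Clones⇔exchange : ∀ {N : MatroidData n} {x y} → x ≢ y → x ∈ E N → y ∈ E N →
                  Clones N x y ⇔
                  (∀ X → X ⊆ E N → x ∈ X → y ∉ X → Indep N (⁅ y ⁆ ∪ (X - x)) ⇔ Indep N X)
Clones⇔exchange {N = N} {x} {y} x≢y x∈E y∈E = mk⇔ forth back
  where
  forth : Clones N x y → ∀ X → X ⊆ E N → x ∈ X → y ∉ X → Indep N (⁅ y ⁆ ∪ (X - x)) ⇔ Indep N X
  forth (_ , _ , invariant) X X⊆E x∈X y∉X = mk⇔ (subst T eq) (subst T (sym eq))
    where
    eq : Ind N (⁅ y ⁆ ∪ (X - x)) ≡ Ind N X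
    eq = trans (cong (Ind N) (sym (swapSet-exchanges x≢y x∈X y∉X))) (invariant X X⊆E)
  back : (∀ X → X ⊆ E N → x ∈ X → y ∉ X → Indep N (⁅ y ⁆ ∪ (X - x)) ⇔ Indep N X) → Clones N x y
  back exchange = x∈E , y∈E , invariant
    where
    invariant : ∀ X → X ⊆ E N → Ind N (swapSet x y X) ≡ Ind N X
    invariant X X⊆E with x ∈? X | y ∈? X
    ... | yes x∈X | yes y∈X = cong (Ind N) (swapSet-fixes (λ _ → y∈X) (λ _ → x∈X))
    ... | no x∉X  | no y∉X  = cong (Ind N) (swapSet-fixes (⊥-elim ∘ x∉X) (⊥-elim ∘ y∉X))
    ... | yes x∈X | no y∉X  =
      trans (cong (Ind N) (swapSet-exchanges x≢y x∈X y∉X)) (T-injective (exchange X X⊆E x∈X y∉X))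
    ... | no x∉X  | yes y∈X = begin
      Ind N (swapSet x y X)      ≡⟨ cong (Ind N) (swapSet-comm x y X) ⟩
      Ind N (swapSet y x X)      ≡⟨ cong (Ind N) (swapSet-exchanges (x≢y ∘ sym) y∈X x∉X) ⟩
      Ind N X′                   ≡⟨ T-injective (exchange X′ X′⊆E (y∈⁅y⁆∪p x _) y∉X′) ⟨
      Ind N (⁅ y ⁆ ∪ (X′ - x))   ≡⟨ cong (λ Z → Ind N (⁅ y ⁆ ∪ Z)) ([⁅x⁆∪p]-x (x∉X ∘ p-y⊆p X y)) ⟩
      Ind N (⁅ y ⁆ ∪ (X - y))    ≡⟨ cong (Ind N) (⁅x⁆∪[p-x] y∈X) ⟩
      Ind N X                    ∎
      where
      open ≡-Reasoning
      X′ = ⁅ x ⁆ ∪ (X - y)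
      X′⊆E : X′ ⊆ E N
      X′⊆E = ⁅y⁆∪p⊆q x∈E (X⊆E ∘ p-y⊆p X y)
      y∉X′ : y ∉ X′
      y∉X′ = x∉⁅y⁆∪p (x≢y ∘ sym) (y∉p-y X y)

-- Counting flats through an element

record Separates (M : MatroidData n) (k : ℕ) (H : Subset n) (x y : Fin n) : Set where
  constructor separates
  field
    flat     : T (isFlat M H)
    rank≡    : rank M H ≡ k
    contains : x ∈ H
    avoids   : y ∉ H

separatesᵇ : MatroidData n → ℕ → Fin n → Fin n → Subset n → Bool
separatesᵇ M k x y H = (isFlat M H ∧ (rank M H ≡ᵇ k) ∧ (x ∈ᵇ H)) ∧ not (y ∈ᵇ H)

separatesᵇ⇔ : ∀ {M : MatroidData n} {k x y H} → T (separatesᵇ M k x y H) ⇔ Separates M k H x y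
separatesᵇ⇔ {M = M} {k} {x} {y} {H} = mk⇔
  (λ t → let through , y∉ = to (T-∧ {isFlat M H ∧ (rank M H ≡ᵇ k) ∧ (x ∈ᵇ H)}) t
             flat , rest   = to (T-∧ {isFlat M H}) through
             rank≡ , x∈    = to (T-∧ {rank M H ≡ᵇ k}) rest in
    separates flat (ℕ.≡ᵇ⇒≡ _ _ rank≡) (to ∈ᵇ⇔ x∈) (to T-not⇔ y∉ ∘ from ∈ᵇ⇔))
  (λ { (separates flat rank≡ x∈ y∉) →
    from (T-∧ {isFlat M H ∧ (rank M H ≡ᵇ k) ∧ (x ∈ᵇ H)})
      (from (T-∧ {isFlat M H}) (flat , from (T-∧ {rank M H ≡ᵇ k}) (ℕ.≡⇒≡ᵇ _ _ rank≡ , from ∈ᵇ⇔ x∈)) ,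
       from T-not⇔ (y∉ ∘ to ∈ᵇ⇔)) })

W≡W⇔ : ∀ (M : MatroidData n) k x y →
       W M k x ≡ W M k y ⇔ count (separatesᵇ M k x y) ≡ count (separatesᵇ M k y x)
W≡W⇔ M k x y = mk⇔
  (λ W≡W → ℕ.+-cancelˡ-≡ (both x y) _ _ (begin
    both x y + count (separatesᵇ M k x y)   ≡⟨ W-split x y ⟨
    W M k x                                 ≡⟨ W≡W ⟩
    W M k y                                 ≡⟨ W-split y x ⟩
    both y x + count (separatesᵇ M k y x)   ≡⟨ cong (_+ count (separatesᵇ M k y x)) both-comm ⟨
    both x y + count (separatesᵇ M k y x)   ∎))
  (λ count≡ → trans (W-split x y) (trans (cong₂ _+_ both-comm count≡) (sym (W-split y x))))
  where
  open ≡-Reasoning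
  through : Fin _ → Subset _ → Bool
  through x H = isFlat M H ∧ (rank M H ≡ᵇ k) ∧ (x ∈ᵇ H)
  both : Fin _ → Fin _ → ℕ
  both x y = count (λ H → through x H ∧ (y ∈ᵇ H))
  W-split : ∀ x y → W M k x ≡ both x y + count (separatesᵇ M k x y)
  W-split x y = count-split (through x) (y ∈ᵇ_)
  ∧-swap : ∀ a b c d → (a ∧ b ∧ c) ∧ d ≡ (a ∧ b ∧ d) ∧ c
  ∧-swap true  true  c d = ∧-comm c d
  ∧-swap true  false c d = refl
  ∧-swap false b     c d = refl
  both-comm : both x y ≡ both y x
  both-comm = count-cong λ H → ∧-swap (isFlat M H) (rank M H ≡ᵇ k) (x ∈ᵇ H) (y ∈ᵇ H)

-- The exchange map ψ

module Correspondence {M : MatroidData n} (isM : IsMatroid M) {f g : Fin n}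
                      (f∈E : f ∈ E M) (g∈E : g ∈ E M) (f≢g : f ≢ g) (freer : Freer M f g)
                      (k : ℕ) (k<r : suc k ≤ rk M) where
  open Matroid isM

  ψ : Subset n → Subset n
  ψ H = cl M (⁅ g ⁆ ∪ (H - f))

  g+[H-f]⊆ψH : ∀ {H} → T (isFlat M H) → ⁅ g ⁆ ∪ (H - f) ⊆ ψ H
  g+[H-f]⊆ψH {H} flatH = ⊆cl (⁅y⁆∪p⊆q g∈E (isFlat⇒⊆E M flatH ∘ p-y⊆p H f))

  f∉cl[H-f] : ∀ {H} → Separates M k H f g → f ∉ cl M (H - f)
  f∉cl[H-f] {H} (separates flatH _ _ g∉H) f∈cl =
    g∉H (cl⊆flat flatH (p-y⊆p H f) (freer⇒∈cl freer (y∉p-y H f) f∈cl))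

  g∉cl[H-f] : ∀ {H} → Separates M k H f g → g ∉ cl M (H - f)
  g∉cl[H-f] {H} (separates flatH _ _ g∉H) = g∉H ∘ cl⊆flat flatH (p-y⊆p H f)

  exchange-g-for-f : ∀ {X} → f ∈ X → g ∉ X → Indep M (⁅ g ⁆ ∪ (X - f)) → Indep M X
  exchange-g-for-f {X} f∈X g∉X indepZ = subst (Indep M) Z-g+f≡X (∉cl⇒indep indepZ-g f∈E f∉cl)
    where
    Z = ⁅ g ⁆ ∪ (X - f)
    g∈Z : g ∈ Z
    g∈Z = y∈⁅y⁆∪p g (X - f)
    Z-g≡X-f : Z - g ≡ X - f
    Z-g≡X-f = [⁅x⁆∪p]-x (g∉X ∘ p-y⊆p X f)
    indepZ-g : Indep M (Z - g)
    indepZ-g = indep-⊆ (p-y⊆p Z g) indepZ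
    f∉cl : f ∉ cl M (Z - g)
    f∉cl f∈cl = indep⇒∉cl-rest indepZ g∈Z
                  (freer⇒∈cl freer (subst (f ∉_) (sym Z-g≡X-f) (y∉p-y X f)) f∈cl)
    Z-g+f≡X : ⁅ f ⁆ ∪ (Z - g) ≡ X
    Z-g+f≡X = trans (cong (⁅ f ⁆ ∪_) Z-g≡X-f) (⁅x⁆∪[p-x] f∈X)

  rank[H-f] : ∀ {H} → Separates M k H f g → suc (rank M (H - f)) ≡ k
  rank[H-f] {H} sep@(separates flatH rank≡k f∈H _) = begin
    suc (rank M (H - f))         ≡⟨ rank-insert-∉cl f∈E (f∉cl[H-f] sep) ⟨
    rank M (⁅ f ⁆ ∪ (H - f))     ≡⟨ cong (rank M) (⁅x⁆∪[p-x] f∈H) ⟩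
    rank M H                     ≡⟨ rank≡k ⟩
    k                            ∎
    where open ≡-Reasoning

  ψ-separates : ∀ {H} → Separates M k H f g → Separates M k (ψ H) g f
  ψ-separates {H} sep@(separates flatH _ f∈H g∉H) = separates (cl-isFlat _) rank≡k g∈ψ f∉ψ
    where
    rank≡k : rank M (ψ H) ≡ k
    rank≡k = trans (rank-cl _) (trans (rank-insert-∉cl g∈E (g∉cl[H-f] sep)) (rank[H-f] sep))
    g∈ψ : g ∈ ψ H
    g∈ψ = g+[H-f]⊆ψH flatH (y∈⁅y⁆∪p g _)
    cl[f+[H-f]]≡H : cl M (⁅ f ⁆ ∪ (H - f)) ≡ H
    cl[f+[H-f]]≡H = trans (cong (cl M) (⁅x⁆∪[p-x] f∈H)) (isFlat⇒closed M flatH)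
    f∉ψ : f ∉ ψ H
    f∉ψ f∈ψ = g∉H (subst (g ∈_) cl[f+[H-f]]≡H (cl-exchange (f∉cl[H-f] sep) g∈E f∈ψ))

  cl-insert-f-separates : ∀ {I} → Indep M I → f ∉ cl M I → g ∉ cl M I → suc ∣ I ∣ ≡ k →
                          f ∉ cl M (⁅ g ⁆ ∪ I) →
                          Separates M k (cl M (⁅ f ⁆ ∪ I)) f g × ψ (cl M (⁅ f ⁆ ∪ I)) ≡ cl M (⁅ g ⁆ ∪ I)
  cl-insert-f-separates {I} indepI f∉clI g∉clI ∣I∣≡ f∉cl[g+I] =
    sep , sym (flat-⊆-rank-≡ (cl-isFlat _) (cl-isFlat _) cl[g+I]⊆ψH
                             (trans (rank-insert g∈E g∉clI) (sym rank-ψH)))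
    where
    H = cl M (⁅ f ⁆ ∪ I)
    rank-insert : ∀ {x} → x ∈ E M → x ∉ cl M I → rank M (cl M (⁅ x ⁆ ∪ I)) ≡ k
    rank-insert x∈E x∉clI =
      trans (rank-cl _) (trans (rank-insert-∉cl x∈E x∉clI) (trans (cong suc (rank-indep indepI)) ∣I∣≡))
    f+I⊆H : ⁅ f ⁆ ∪ I ⊆ H
    f+I⊆H = ⊆cl (⁅y⁆∪p⊆q f∈E (indep⇒⊆E indepI))
    sep : Separates M k H f g
    sep = separates (cl-isFlat _) (rank-insert f∈E f∉clI) (f+I⊆H (y∈⁅y⁆∪p f I))
                    (f∉cl[g+I] ∘ cl-exchange g∉clI f∈E)
    rank-ψH : rank M (ψ H) ≡ k
    rank-ψH = Separates.rank≡ (ψ-separates sep)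
    I⊆H-f : I ⊆ H - f
    I⊆H-f x∈I = x∈p∧x≢y⇒x∈p-y (f+I⊆H (p⊆⁅y⁆∪p f I x∈I)) (λ { refl → f∉clI (⊆cl (indep⇒⊆E indepI) x∈I) })
    cl[g+I]⊆ψH : cl M (⁅ g ⁆ ∪ I) ⊆ ψ H
    cl[g+I]⊆ψH = cl-mono (⁅y⁆∪-mono g I⊆H-f)

  ψ-onto : Indep M ⁅ g ⁆ → ∀ {H} → Separates M k H g f → ∃ λ H′ → Separates M k H′ f g × ψ H′ ≡ H
  ψ-onto indep-g {H} (separates flatH rank≡k g∈H f∉H) with extend-to-basis indep-g (⁅x⁆⊆p g∈H)
  ... | B , ⁅g⁆⊆B , basis = cl M (⁅ f ⁆ ∪ I) , proj₁ sep-ψ , trans (proj₂ sep-ψ) cl[g+I]≡H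
    where
    g∈B : g ∈ B
    g∈B = ⁅g⁆⊆B (x∈⁅x⁆ g)
    I = B - g
    cl[g+I]≡H : cl M (⁅ g ⁆ ∪ I) ≡ H
    cl[g+I]≡H = trans (cong (cl M) (⁅x⁆∪[p-x] g∈B)) (trans (cl-basis basis) (isFlat⇒closed M flatH))
    ∣I∣≡k : suc ∣ I ∣ ≡ k
    ∣I∣≡k = trans (∣p-x∣ B g g∈B) (trans (card basis) rank≡k)
    f∉cl[g+I] : f ∉ cl M (⁅ g ⁆ ∪ I)
    f∉cl[g+I] = f∉H ∘ subst (f ∈_) cl[g+I]≡H
    sep-ψ : Separates M k (cl M (⁅ f ⁆ ∪ I)) f g × ψ (cl M (⁅ f ⁆ ∪ I)) ≡ cl M (⁅ g ⁆ ∪ I)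
    sep-ψ = cl-insert-f-separates (indep-⊆ (p-y⊆p B g) (indep basis))
              (f∉cl[g+I] ∘ cl-mono (p⊆⁅y⁆∪p g I)) (indep⇒∉cl-rest (indep basis) g∈B) ∣I∣≡k f∉cl[g+I]

  D : Subset n
  D = parallelSet M f g

  parallel-drags-g : ∀ {b F} → b ∈ D → T (isFlat M F) → b ∈ F → g ∈ F
  parallel-drags-g {b} b∈D flatF b∈F with to (∈parallelSet⇔ {N = M}) b∈D
  ... | _ , b∉fg , circuit with to (pair-isCircuit⇔ (b∉fg ∘ b≡g⇒)) circuit
    where
    b≡g⇒ : b ≡ g → b ∈ ⁅ f ⁆ ∪ ⁅ g ⁆
    b≡g⇒ refl = p⊆⁅y⁆∪p f ⁅ g ⁆ (x∈⁅x⁆ b)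
  ... | indep-b , _ , dependent =
    cl⊆flat flatF (⁅x⁆⊆p b∈F)
      (dependent⇒∈cl indep-b g∈E (subst (λ Z → ¬ Indep M Z) (∪-comm ⁅ b ⁆ ⁅ g ⁆) dependent))

  dependent-pair⇒parallel : ∀ {b} → b ∈ E M → b ≢ f → b ≢ g → Indep M ⁅ b ⁆ → Indep M ⁅ g ⁆ →
                            ¬ Indep M (⁅ b ⁆ ∪ ⁅ g ⁆) → b ∈ D
  dependent-pair⇒parallel b∈E b≢f b≢g indep-b indep-g dependent =
    from (∈parallelSet⇔ {N = M})
      (b∈E , x∉⁅y⁆∪p b≢f (x≢y⇒x∉⁅y⁆ b≢g) , from (pair-isCircuit⇔ b≢g) (indep-b , indep-g , dependent))

  ∉D : ∀ {x} → x ∈ ⁅ f ⁆ ∪ ⁅ g ⁆ → x ∉ D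
  ∉D x∈fg x∈D = proj₁ (proj₂ (to (∈parallelSet⇔ {N = M}) x∈D)) x∈fg

  separating-⊆E─D : ∀ {H} → Separates M k H f g → H ⊆ E M ─ D
  separating-⊆E─D (separates flatH _ _ g∉H) x∈H =
    x∈p∧x∉q⇒x∈p─q (isFlat⇒⊆E M flatH x∈H) (λ x∈D → g∉H (parallel-drags-g x∈D flatH x∈H))

  Candidate : Subset n → Set
  Candidate Y = Y ⊆ E M ─ D × Indep M Y × ∣ Y ∣ ≤ suc k × f ∈ Y × g ∉ Y

  Exchangeable : Set
  Exchangeable = ∀ Y → Candidate Y → Indep M (⁅ g ⁆ ∪ (Y - f))

  insert-basis-spans-ψ : ∀ {H B x} → Separates M k H f g → IsBasis B (H - f) → x ∈ ψ H → x ∉ H →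
                         Indep M (⁅ x ⁆ ∪ B) × cl M (⁅ x ⁆ ∪ B) ≡ ψ H
  insert-basis-spans-ψ {H} {B} {x} sep@(separates flatH _ _ _) basis x∈ψH x∉H = indep-xB , cl[x+B]≡ψH
    where
    B⊆H : B ⊆ H
    B⊆H = p-y⊆p H f ∘ ⊆set basis
    indep-xB : Indep M (⁅ x ⁆ ∪ B)
    indep-xB = ∉cl⇒indep (indep basis) (∈cl⇒∈E M x∈ψH) (x∉H ∘ cl⊆flat flatH B⊆H)
    x+B⊆ψH : ⁅ x ⁆ ∪ B ⊆ ψ H
    x+B⊆ψH = ⁅y⁆∪p⊆q x∈ψH (g+[H-f]⊆ψH flatH ∘ p⊆⁅y⁆∪p g _ ∘ ⊆set basis)
    rank≡ : rank M (cl M (⁅ x ⁆ ∪ B)) ≡ rank M (ψ H)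
    rank≡ = begin
      rank M (cl M (⁅ x ⁆ ∪ B))   ≡⟨ trans (rank-cl _) (rank-indep indep-xB) ⟩
      ∣ ⁅ x ⁆ ∪ B ∣               ≡⟨ ∣⁅x⁆∪p∣ x B (x∉H ∘ B⊆H) ⟩
      suc ∣ B ∣                   ≡⟨ cong suc (card basis) ⟩
      suc (rank M (H - f))        ≡⟨ rank[H-f] sep ⟩
      k                           ≡⟨ Separates.rank≡ (ψ-separates sep) ⟨
      rank M (ψ H)                ∎
      where open ≡-Reasoning
    cl[x+B]≡ψH : cl M (⁅ x ⁆ ∪ B) ≡ ψ H
    cl[x+B]≡ψH = flat-⊆-rank-≡ (cl-isFlat _) (cl-isFlat _) (cl⊆flat (cl-isFlat _) x+B⊆ψH) rank≡

  ψ-collision⇒blocked : ∀ {H₁ H₂ x} → Separates M k H₁ f g → Separates M k H₂ f g → ψ H₁ ≡ ψ H₂ →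
                        x ∈ H₁ → x ∉ H₂ → ∃ λ Y → Candidate Y × ¬ Indep M (⁅ g ⁆ ∪ (Y - f))
  ψ-collision⇒blocked {H₁} {H₂} {x} sep₁@(separates flat₁ _ _ g∉H₁) sep₂@(separates _ _ f∈H₂ g∉H₂) ψ≡ x∈H₁ x∉H₂
    with basis-exists (H₂ - f)
  ... | B , basis =
    ⁅ f ⁆ ∪ XB , candidate , subst (λ Z → ¬ Indep M (⁅ g ⁆ ∪ Z)) (sym ([⁅x⁆∪p]-x f∉XB)) g+XB-dependent
    where
    XB = ⁅ x ⁆ ∪ B
    x≢f : x ≢ f
    x≢f refl = x∉H₂ f∈H₂
    B⊆H₂ : B ⊆ H₂
    B⊆H₂ = p-y⊆p H₂ f ∘ ⊆set basis
    x∈ψH₂ : x ∈ ψ H₂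
    x∈ψH₂ = subst (x ∈_) ψ≡ (g+[H-f]⊆ψH flat₁ (p⊆⁅y⁆∪p g _ (x∈p∧x≢y⇒x∈p-y x∈H₁ x≢f)))
    spans = insert-basis-spans-ψ sep₂ basis x∈ψH₂ x∉H₂
    f∉XB : f ∉ XB
    f∉XB = x∉⁅y⁆∪p (x≢f ∘ sym) (λ f∈B → y∉p-y H₂ f (⊆set basis f∈B))
    g∉XB : g ∉ XB
    g∉XB = x∉⁅y⁆∪p (λ { refl → g∉H₁ x∈H₁ }) (g∉H₂ ∘ B⊆H₂)
    candidate : Candidate (⁅ f ⁆ ∪ XB)
    candidate = ⁅y⁆∪p⊆q (x∈p∧x∉q⇒x∈p─q f∈E (∉D (y∈⁅y⁆∪p f ⁅ g ⁆)))
                        (⁅y⁆∪p⊆q (separating-⊆E─D sep₁ x∈H₁) (separating-⊆E─D sep₂ ∘ B⊆H₂)) ,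
                ∉cl⇒indep (proj₁ spans) f∈E (Separates.avoids (ψ-separates sep₂) ∘ subst (f ∈_) (proj₂ spans)) ,
                ℕ.≤-reflexive ∣Y∣≡ ,
                y∈⁅y⁆∪p f XB ,
                x∉⁅y⁆∪p (f≢g ∘ sym) g∉XB
      where
      ∣Y∣≡ : ∣ ⁅ f ⁆ ∪ XB ∣ ≡ suc k
      ∣Y∣≡ = begin
        ∣ ⁅ f ⁆ ∪ XB ∣               ≡⟨ ∣⁅x⁆∪p∣ f XB f∉XB ⟩
        suc ∣ XB ∣                   ≡⟨ cong suc (trans (rank-cl XB) (rank-indep (proj₁ spans))) ⟨
        suc (rank M (cl M XB))       ≡⟨ cong (suc ∘ rank M) (proj₂ spans) ⟩
        suc (rank M (ψ H₂))          ≡⟨ cong suc (Separates.rank≡ (ψ-separates sep₂)) ⟩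
        suc k                        ∎
        where open ≡-Reasoning
    g+XB-dependent : ¬ Indep M (⁅ g ⁆ ∪ XB)
    g+XB-dependent =
      ∈cl⇒dependent (proj₁ spans) (subst (g ∈_) (sym (proj₂ spans)) (Separates.contains (ψ-separates sep₂)))
                    g∉XB

  ψ-injective : Exchangeable → ∀ {H₁ H₂} → Separates M k H₁ f g → Separates M k H₂ f g →
                ψ H₁ ≡ ψ H₂ → H₁ ≡ H₂
  ψ-injective exchangeable sep₁ sep₂ ψ≡ = ⊆-antisym (included sep₁ sep₂ ψ≡) (included sep₂ sep₁ (sym ψ≡))
    where
    included : ∀ {H₁ H₂} → Separates M k H₁ f g → Separates M k H₂ f g → ψ H₁ ≡ ψ H₂ → H₁ ⊆ H₂
    included {H₂ = H₂} sep₁ sep₂ ψ≡ {x} x∈H₁ = decidable-stable (x ∈? H₂) λ x∉H₂ →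
      let Y , candidate , blocked = ψ-collision⇒blocked sep₁ sep₂ ψ≡ x∈H₁ x∉H₂ in
      blocked (exchangeable Y candidate)

  spanning-exchange : ∀ {Z b} → Indep M Z → ∣ Z ∣ ≡ k → f ∉ cl M Z → b ∈ Z → b ∈ cl M (⁅ g ⁆ ∪ (Z - b)) →
                      Separates M k (cl M (⁅ f ⁆ ∪ (Z - b))) f g × ψ (cl M (⁅ f ⁆ ∪ (Z - b))) ≡ cl M Z
  spanning-exchange {Z} {b} indepZ ∣Z∣≡k f∉clZ b∈Z b∈cl =
    let sep , ψ≡ = cl-insert-f-separates indepI (f∉clZ ∘ cl-mono (p-y⊆p Z b)) g∉clI ∣I∣≡k
                                         (f∉clZ ∘ subst (f ∈_) (sym clZ≡cl[g+I]))
    in sep , trans ψ≡ (sym clZ≡cl[g+I])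
    where
    I = Z - b
    indepI : Indep M I
    indepI = indep-⊆ (p-y⊆p Z b) indepZ
    ∣I∣≡k : suc ∣ I ∣ ≡ k
    ∣I∣≡k = trans (∣p-x∣ Z b b∈Z) ∣Z∣≡k
    g∉clI : g ∉ cl M I
    g∉clI g∈clI = indep⇒∉cl-rest indepZ b∈Z (subst (b ∈_) (cl-insert-∈cl g∈clI) b∈cl)
    Z⊆cl[g+I] : Z ⊆ cl M (⁅ g ⁆ ∪ I)
    Z⊆cl[g+I] = subst (_⊆ cl M (⁅ g ⁆ ∪ I)) (⁅x⁆∪[p-x] b∈Z)
                  (⁅y⁆∪p⊆q b∈cl (⊆cl (⁅y⁆∪p⊆q g∈E (indep⇒⊆E indepI)) ∘ p⊆⁅y⁆∪p g I))
    clZ≡cl[g+I] : cl M Z ≡ cl M (⁅ g ⁆ ∪ I)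
    clZ≡cl[g+I] = flat-⊆-rank-≡ (cl-isFlat Z) (cl-isFlat _) (cl-least Z⊆cl[g+I]) (begin
      rank M (cl M Z)                ≡⟨ trans (rank-cl Z) (rank-indep indepZ) ⟩
      ∣ Z ∣                          ≡⟨ trans ∣Z∣≡k (sym ∣I∣≡k) ⟩
      suc ∣ I ∣                      ≡⟨ cong suc (rank-indep indepI) ⟨
      suc (rank M I)                 ≡⟨ rank-insert-∉cl g∈E g∉clI ⟨
      rank M (⁅ g ⁆ ∪ I)             ≡⟨ rank-cl _ ⟨
      rank M (cl M (⁅ g ⁆ ∪ I))      ∎)
      where open ≡-Reasoning

  Collision : Set
  Collision = ∃ λ H₁ → ∃ λ H₂ → Separates M k H₁ f g × Separates M k H₂ f g × H₁ ≢ H₂ × ψ H₁ ≡ ψ H₂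

  spanning-pair⇒collision : ∀ {Z b₁ b₂} → Indep M Z → ∣ Z ∣ ≡ suc k → f ∈ Z →
                            b₁ ∈ Z - f → b₂ ∈ Z - f → b₂ ≢ b₁ →
                            b₁ ∈ cl M (⁅ g ⁆ ∪ ((Z - f) - b₁)) → b₂ ∈ cl M (⁅ g ⁆ ∪ ((Z - f) - b₂)) → Collision
  spanning-pair⇒collision {Z} {b₁} {b₂} indepZ ∣Z∣≡ f∈Z b₁∈Z′ b₂∈Z′ b₂≢b₁ b₁-spans b₂-spans =
    H b₁ , H b₂ , proj₁ sep-ψ₁ , proj₁ sep-ψ₂ , H-distinct , trans (proj₂ sep-ψ₁) (sym (proj₂ sep-ψ₂))
    where
    Z′ = Z - f
    indepZ′ : Indep M Z′
    indepZ′ = indep-⊆ (p-y⊆p Z f) indepZ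
    H : Fin n → Subset n
    H b = cl M (⁅ f ⁆ ∪ (Z′ - b))
    H-separates : ∀ {b} → b ∈ Z′ → b ∈ cl M (⁅ g ⁆ ∪ (Z′ - b)) → Separates M k (H b) f g × ψ (H b) ≡ cl M Z′
    H-separates =
      spanning-exchange indepZ′ (ℕ.suc-injective (trans (∣p-x∣ Z f f∈Z) ∣Z∣≡)) (indep⇒∉cl-rest indepZ f∈Z)
    sep-ψ₁ = H-separates b₁∈Z′ b₁-spans
    sep-ψ₂ = H-separates b₂∈Z′ b₂-spans
    b₂∈H₁ : b₂ ∈ H b₁
    b₂∈H₁ = ⊆cl (⁅y⁆∪p⊆q f∈E (indep⇒⊆E indepZ′ ∘ p-y⊆p Z′ b₁)) (p⊆⁅y⁆∪p f _ (x∈p∧x≢y⇒x∈p-y b₂∈Z′ b₂≢b₁))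
    H₂⊆cl[Z-b₂] : H b₂ ⊆ cl M (Z - b₂)
    H₂⊆cl[Z-b₂] = cl-mono (⁅y⁆∪p⊆q (x∈p∧x≢y⇒x∈p-y f∈Z (λ { refl → y∉p-y Z f b₂∈Z′ })) (-y-mono b₂ (p-y⊆p Z f)))
    H-distinct : H b₁ ≢ H b₂
    H-distinct H≡ = indep⇒∉cl-rest indepZ (p-y⊆p Z f b₂∈Z′) (H₂⊆cl[Z-b₂] (subst (b₂ ∈_) H≡ b₂∈H₁))

  blocked⇒wide-circuit : Indep M ⁅ g ⁆ → ∀ {Y} → Candidate Y → ¬ Indep M (⁅ g ⁆ ∪ (Y - f)) →
                         ∃ λ C → T (isCircuit M C) × C ⊆ ⁅ g ⁆ ∪ (Y - f) ×
                                 ¬ C ⊆ ⁅ g ⁆ × (∀ {b} → b ∈ C → b ∉ ⁅ g ⁆ → ¬ C ⊆ ⁅ b ⁆ ∪ ⁅ g ⁆)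
  blocked⇒wide-circuit indep-g {Y} (Y⊆E─D , indepY , _ , _ , _) blocked
    with circuit-through (indep-⊆ (p-y⊆p Y f) indepY) g∈E blocked
  ... | C , C⊆g+[Y-f] , _ , circuit = C , circuit , C⊆g+[Y-f] , C⊈⁅g⁆ , C⊈⁅b⁆∪⁅g⁆
    where
    C⊈⁅g⁆ : ¬ C ⊆ ⁅ g ⁆
    C⊈⁅g⁆ C⊆⁅g⁆ = isCircuit⇒dependent M circuit (indep-⊆ C⊆⁅g⁆ indep-g)
    C⊈⁅b⁆∪⁅g⁆ : ∀ {b} → b ∈ C → b ∉ ⁅ g ⁆ → ¬ C ⊆ ⁅ b ⁆ ∪ ⁅ g ⁆
    C⊈⁅b⁆∪⁅g⁆ {b} b∈C b∉⁅g⁆ C⊆pair =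
      x∈p─q⇒x∉q (E M) D (Y⊆E─D b∈Y)
        (dependent-pair⇒parallel (indep⇒⊆E indepY b∈Y) b≢f (b∉⁅g⁆ ∘ x≡y⇒x∈⁅y⁆)
          (indep-⊆ (⁅x⁆⊆p b∈Y) indepY) indep-g (dependent-⊇ C⊆pair (isCircuit⇒dependent M circuit)))
      where
      b∈Y-f : b ∈ Y - f
      b∈Y-f = [ (λ { refl → ⊥-elim (b∉⁅g⁆ (x∈⁅x⁆ g)) }) , id ]′ (x∈⁅y⁆∪p⁻ g (Y - f) (C⊆g+[Y-f] b∈C))
      b∈Y = p-y⊆p Y f b∈Y-f
      b≢f = proj₂ (x∈p-y⁻ Y f b∈Y-f)

  blocked⇒collision : Indep M ⁅ g ⁆ → ∀ {Y} → Candidate Y → ¬ Indep M (⁅ g ⁆ ∪ (Y - f)) → Collision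
  blocked⇒collision indep-g {Y} candidate@(_ , indepY , ∣Y∣≤ , f∈Y , _) blocked
    with extend-to-size indepY (indep⇒⊆E indepY) ∣Y∣≤ k<r | blocked⇒wide-circuit indep-g candidate blocked
  ... | Z , Y⊆Z , _ , indepZ , ∣Z∣≡ | C , circuit , C⊆g+[Y-f] , C⊈⁅g⁆ , C⊈⁅b⁆∪⁅g⁆ =
    let b₁ , b₁∈C , b₁∉⁅g⁆      = ∃-∈-∉ C ⁅ g ⁆ C⊈⁅g⁆
        b₂ , b₂∈C , b₂∉⁅b₁⁆∪⁅g⁆ = ∃-∈-∉ C (⁅ b₁ ⁆ ∪ ⁅ g ⁆) (C⊈⁅b⁆∪⁅g⁆ b₁∈C b₁∉⁅g⁆)
        b₂∉⁅g⁆                   = b₂∉⁅b₁⁆∪⁅g⁆ ∘ p⊆⁅y⁆∪p b₁ ⁅ g ⁆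
    in spanning-pair⇒collision indepZ ∣Z∣≡ (Y⊆Z f∈Y) (C-g⊆Z′ b₁∈C b₁∉⁅g⁆) (C-g⊆Z′ b₂∈C b₂∉⁅g⁆)
         (b₂∉⁅b₁⁆∪⁅g⁆ ∘ x∈p∪q⁺ ∘ inj₁ ∘ x≡y⇒x∈⁅y⁆) (spans b₁∈C b₁∉⁅g⁆) (spans b₂∈C b₂∉⁅g⁆)
    where
    C-g⊆Z′ : ∀ {b} → b ∈ C → b ∉ ⁅ g ⁆ → b ∈ Z - f
    C-g⊆Z′ b∈C b∉⁅g⁆ =
      -y-mono f Y⊆Z ([ (λ { refl → ⊥-elim (b∉⁅g⁆ (x∈⁅x⁆ g)) }) , id ]′ (x∈⁅y⁆∪p⁻ g (Y - f) (C⊆g+[Y-f] b∈C)))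
    spans : ∀ {b} → b ∈ C → b ∉ ⁅ g ⁆ → b ∈ cl M (⁅ g ⁆ ∪ ((Z - f) - b))
    spans {b} b∈C b∉⁅g⁆ = cl-mono C-b⊆ (circuit-∈cl circuit b∈C)
      where
      C-b⊆ : C - b ⊆ ⁅ g ⁆ ∪ ((Z - f) - b)
      C-b⊆ {c} c∈ with x∈p-y⁻ C b c∈ | c ∈? ⁅ g ⁆
      ... | _   , _   | yes c∈⁅g⁆ = subst (_∈ _) (sym (x∈⁅y⁆⇒x≡y g c∈⁅g⁆)) (y∈⁅y⁆∪p g _)
      ... | c∈C , c≢b | no c∉⁅g⁆  = p⊆⁅y⁆∪p g _ (x∈p∧x≢y⇒x∈p-y (C-g⊆Z′ c∈C c∉⁅g⁆) c≢b)

  loop⇒¬separates : ¬ Indep M ⁅ g ⁆ → ∀ {H} → ¬ Separates M k H f g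
  loop⇒¬separates loop-g (separates flatH _ _ g∉H) = g∉H (loop∈flat g∈E loop-g flatH)

  loop⇒exchangeable⇒¬separates : ¬ Indep M ⁅ g ⁆ → Exchangeable → ∀ {H} → ¬ Separates M k H g f
  loop⇒exchangeable⇒¬separates loop-g exchangeable (separates flatH _ _ f∉H) with T? (Ind M ⁅ f ⁆)
  ... | no loop-f    = f∉H (loop∈flat f∈E loop-f flatH)
  ... | yes indep-f  = loop-g (indep-⊆ (p⊆p∪q _) (exchangeable ⁅ f ⁆ candidate))
    where
    candidate : Candidate ⁅ f ⁆
    candidate = ⁅x⁆⊆p (x∈p∧x∉q⇒x∈p─q f∈E (∉D (y∈⁅y⁆∪p f ⁅ g ⁆))) , indep-f ,
                ℕ.≤-trans (ℕ.≤-reflexive (∣⁅x⁆∣≡1 f)) (s≤s z≤n) , x∈⁅x⁆ f , x≢y⇒x∉⁅y⁆ (f≢g ∘ sym)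

  loop⇒candidate⇒separates : ¬ Indep M ⁅ g ⁆ → ∀ {Y} → Candidate Y → ∃ λ H → Separates M k H g f
  loop⇒candidate⇒separates loop-g (_ , indepY , _ , f∈Y , _) =
    let F , flatF , rankF , f∉F = nonloop-avoiding-flat (indep-⊆ (⁅x⁆⊆p f∈Y) indepY) k<r in
    F , separates flatF rankF (loop∈flat g∈E loop-g flatF) f∉F

  count≡count⇔exchangeable : count (separatesᵇ M k f g) ≡ count (separatesᵇ M k g f) ⇔ Exchangeable
  count≡count⇔exchangeable = mk⇔ (λ count≡ Y candidate → forth count≡ candidate (T? (Ind M ⁅ g ⁆)))
                                 (λ exchangeable → back exchangeable (T? (Ind M ⁅ g ⁆)))
    where
    A B : Subset n → Bool
    A = separatesᵇ M k f g
    B = separatesᵇ M k g f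
    A⇔ : ∀ {H} → T (A H) ⇔ Separates M k H f g
    A⇔ {H} = separatesᵇ⇔ {M = M} {k} {f} {g} {H}
    B⇔ : ∀ {H} → T (B H) ⇔ Separates M k H g f
    B⇔ {H} = separatesᵇ⇔ {M = M} {k} {g} {f} {H}
    A-empty : ¬ Indep M ⁅ g ⁆ → count A ≡ 0
    A-empty loop-g = count-none A λ H → loop⇒¬separates loop-g ∘ to A⇔
    ψ-onto′ : Indep M ⁅ g ⁆ → ∀ H → T (B H) → ∃ λ H′ → T (A H′) × ψ H′ ≡ H
    ψ-onto′ indep-g H t = let H′ , sep′ , ψ≡ = ψ-onto indep-g (to B⇔ t) in H′ , from A⇔ sep′ , ψ≡
    forth : count A ≡ count B → ∀ {Y} → Candidate Y → Dec (Indep M ⁅ g ⁆) → Indep M (⁅ g ⁆ ∪ (Y - f))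
    forth count≡ {Y} candidate (yes indep-g) =
      decidable-stable (T? (Ind M (⁅ g ⁆ ∪ (Y - f)))) (collide ∘ blocked⇒collision indep-g candidate)
      where
      collide : Collision → ⊥
      collide (H₁ , H₂ , sep₁ , sep₂ , H₁≢H₂ , ψ≡) =
        ℕ.<-irrefl (sym count≡)
          (count-<-collapsing A B ψ (ψ-onto′ indep-g) {H₁} {H₂} (from A⇔ sep₁) (from A⇔ sep₂) H₁≢H₂ ψ≡)
    forth count≡ candidate (no loop-g) =
      let H , sep = loop⇒candidate⇒separates loop-g candidate in
      ⊥-elim (ℕ.<-irrefl (trans (sym (A-empty loop-g)) count≡) (count-some B {H} (from B⇔ sep)))
    back : Exchangeable → Dec (Indep M ⁅ g ⁆) → count A ≡ count B
    back exchangeable (yes indep-g) =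
      count-bijection A B ψ (λ _ → from B⇔ ∘ ψ-separates ∘ to A⇔)
        (λ _ _ t₁ t₂ → ψ-injective exchangeable (to A⇔ t₁) (to A⇔ t₂))
        (ψ-onto′ indep-g)
    back exchangeable (no loop-g) =
      trans (A-empty loop-g)
            (sym (count-none B λ H → loop⇒exchangeable⇒¬separates loop-g exchangeable ∘ to B⇔))

  module Truncated (1≤k : 1 ≤ k) where
    open Truncation isM

    i : ℕ
    i = rk M ∸ k ∸ 1

    i≡ : i ≡ rk M ∸ suc k
    i≡ = trans (ℕ.∸-+-assoc (rk M) k 1) (cong (rk M ∸_) (ℕ.+-comm k 1))

    N N′ : MatroidData n
    N  = τ^ i M
    N′ = delete N (parallelSet N f g)

    Indep-N⇔ : ∀ X → Indep N X ⇔ (Indep M X × ∣ X ∣ ≤ suc k)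
    Indep-N⇔ X = subst (λ m → Indep N X ⇔ (Indep M X × ∣ X ∣ ≤ m)) r∸i≡
                   (τ^-Indep⇔ i (subst (_< rk M) (sym i≡) (ℕ.∸-monoʳ-< z<s k<r)) X)
      where
      r∸i≡ : rk M ∸ i ≡ suc k
      r∸i≡ = trans (cong (rk M ∸_) i≡) (ℕ.m∸[m∸n]≡n k<r)

    parallelSet-N : parallelSet N f g ≡ D
    parallelSet-N = parallelSet-cong (E-τ^ i) λ X ∣X∣≤2 →
      T-injective (mk⇔ (proj₁ ∘ to (Indep-N⇔ X))
                       (λ indepX → from (Indep-N⇔ X) (indepX , ℕ.≤-trans ∣X∣≤2 (s≤s 1≤k))))

    E-N′ : E N′ ≡ E M ─ D
    E-N′ = cong₂ _─_ (E-τ^ i) parallelSet-N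

    Indep-N′⁻ : ∀ {X} → Indep N′ X → Indep M X × ∣ X ∣ ≤ suc k × X ⊆ E M ─ D
    Indep-N′⁻ {X} t with to (T-∧ {Ind N X}) t
    ... | indepX , X⊆ = let indepX′ , ∣X∣≤ = to (Indep-N⇔ X) indepX in
                        indepX′ , ∣X∣≤ , subst (X ⊆_) E-N′ (⊆ᵇ⁻ X⊆)

    Indep-N′⁺ : ∀ {X} → Indep M X → ∣ X ∣ ≤ suc k → X ⊆ E M ─ D → Indep N′ X
    Indep-N′⁺ {X} indepX ∣X∣≤ X⊆ =
      from (T-∧ {Ind N X}) (from (Indep-N⇔ X) (indepX , ∣X∣≤) , ⊆ᵇ⁺ (subst (X ⊆_) (sym E-N′) X⊆))

    Clones⇔exchangeable : Clones N′ f g ⇔ Exchangeable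
    Clones⇔exchangeable = ⇔-trans (Clones⇔exchange f≢g (E′ f∈E─D) (E′ g∈E─D)) (mk⇔ forth back)
      where
      E′ : ∀ {x} → x ∈ E M ─ D → x ∈ E N′
      E′ = subst (_ ∈_) (sym E-N′)
      f∈E─D = x∈p∧x∉q⇒x∈p─q f∈E (∉D (y∈⁅y⁆∪p f ⁅ g ⁆))
      g∈E─D = x∈p∧x∉q⇒x∈p─q g∈E (∉D (p⊆⁅y⁆∪p f ⁅ g ⁆ (x∈⁅x⁆ g)))
      Exchange′ : Set
      Exchange′ = ∀ X → X ⊆ E N′ → f ∈ X → g ∉ X → Indep N′ (⁅ g ⁆ ∪ (X - f)) ⇔ Indep N′ X
      forth : Exchange′ → Exchangeable
      forth exchange Y (Y⊆E─D , indepY , ∣Y∣≤ , f∈Y , g∉Y) =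
        proj₁ (Indep-N′⁻ (from (exchange Y (E′ ∘ Y⊆E─D) f∈Y g∉Y) (Indep-N′⁺ indepY ∣Y∣≤ Y⊆E─D)))
      back : Exchangeable → Exchange′
      back exchangeable X X⊆E′ f∈X g∉X = mk⇔
        (λ t → let indepZ , ∣Z∣≤ , _ = Indep-N′⁻ t in
          Indep-N′⁺ (exchange-g-for-f f∈X g∉X indepZ) (subst (_≤ suc k) ∣Z∣≡∣X∣ ∣Z∣≤) X⊆E─D)
        (λ t → let indepX , ∣X∣≤ , _ = Indep-N′⁻ t in
          Indep-N′⁺ (exchangeable X (X⊆E─D , indepX , ∣X∣≤ , f∈X , g∉X))
                    (subst (_≤ suc k) (sym ∣Z∣≡∣X∣) ∣X∣≤) (⁅y⁆∪p⊆q g∈E─D (X⊆E─D ∘ p-y⊆p X f)))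
        where
        Z = ⁅ g ⁆ ∪ (X - f)
        X⊆E─D : X ⊆ E M ─ D
        X⊆E─D = subst (X ⊆_) E-N′ X⊆E′
        ∣Z∣≡∣X∣ : ∣ Z ∣ ≡ ∣ X ∣
        ∣Z∣≡∣X∣ = trans (∣⁅x⁆∪p∣ g (X - f) (g∉X ∘ p-y⊆p X f)) (∣p-x∣ X f f∈X)

corollary15 : ∀ {n} (M : MatroidData n) → IsMatroid M → 2 ≤ rk M →
    (f g : Fin n) → f ∈ E M → g ∈ E M → ¬ (f ≡ g) → Freer M f g →
    (k : ℕ) → 1 ≤ k → k ≤ rk M ∸ 1 →
    (W M k f ≡ W M k g) ⇔
      Clones (delete (τ^ (rk M ∸ k ∸ 1) M)
                     (parallelSet (τ^ (rk M ∸ k ∸ 1) M) f g)) f g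
corollary15 M isM 2≤r f g f∈E g∈E f≢g freer k 1≤k k≤r∸1 = begin
  W M k f ≡ W M k g                                          ∼⟨ W≡W⇔ M k f g ⟩
  count (separatesᵇ M k f g) ≡ count (separatesᵇ M k g f)    ∼⟨ count≡count⇔exchangeable ⟩
  Exchangeable                                               ∼⟨ ⇔-sym (Truncated.Clones⇔exchangeable 1≤k) ⟩
  Clones (delete (τ^ (rk M ∸ k ∸ 1) M) (parallelSet (τ^ (rk M ∸ k ∸ 1) M) f g)) f g ∎
  where
  open Related.EquationalReasoning {k = Related.equivalence}
  k<r : suc k ≤ rk M
  k<r = ℕ.≤-trans (s≤s k≤r∸1) (ℕ.≤-reflexive (trans (ℕ.+-comm 1 _) (ℕ.m∸n+n≡m (ℕ.≤-trans (s≤s z≤n) 2≤r))))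
  open Correspondence isM f∈E g∈E f≢g freer k k<r
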